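{- Let $T_n$ be any tree with $n\ge1$ vertices, regarded as a simplicial complex of dimension at most $1$, and let $s>1$. Then $$ps^1\bigl(\Psi_{\zeta_{s,-q}}(T_n)\bigr)(-1)=(-1)^n(q+2)^{n-1}.$$
   Context: Let $\mathbb{K}$ be a field and $F=\mathrm{frac}(\mathbb{K}[q])$. For a simplicial complex $\Gamma$ (faces have dimension $|X|-1$), $\zeta_s(\Gamma)=1$ if $\dim\Gamma<s$ and $0$ otherwise, and $\zeta_{s,q}(\Gamma)=q^{rk(\Gamma^{(1)})}\zeta_s(\Gamma)$, where $\Gamma^{(1)}$ is the 1-skeleton viewed as a graph and $rk$ of a graph is the number of vertices minus the number of connected components. $\zeta_{s,-q}$ is obtained by replacing $q$ with $-q$. For $\Gamma$ on vertex set $V$, $|V|=n$: $\Psi_{\zeta_{s,-q}}(\Gamma)=\sum_{\alpha\vDash n}\bigl(\sum_{(V_1,\dots,V_k)}\prod_{j=1}^k\zeta_{s,-q}(\Gamma_{V_j})\bigr)M_\alpha$, the inner sum over ordered set partitions of $V$ with $|V_j|=\alpha_j$, where $\alpha=(\alpha_1,\dots,\alpha_k)$, $\Gamma_T=\{X\cap T:X\in\Gamma\}$, and $M_\alpha$ is the monomial quasi-symmetric function. The principal specialization $ps^1$ is the $F$-linear map sending $M_\alpha$ to the polynomial $\binom{t}{\ell(\alpha)}=t(t-1)\cdots(t-\ell(\alpha)+1)/\ell(\alpha)!$ in $t$, $\ell(\alpha)$ the number of parts; $ps^1(g)(-1)$ is its value at $t=-1$. -}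

module Defs where

open import Level using (Level)
open import Data.Bool using (Bool; true; false; _∧_; _∨_; not; if_then_else_; T)
open import Data.Nat using (ℕ; zero; suc; _∸_; _≤ᵇ_; _<ᵇ_; _≤_; _!)
open import Data.Nat.Properties using (_!≢0)
open import Data.Nat.Base using () renaming (_≡ᵇ_ to _==ℕ_)
open import Data.Integer using (ℤ; +_; -[1+_]; _/ℕ_) renaming (_*_ to _*ℤ_; _-_ to _-ℤ_)
open import Data.Fin using (Fin; toℕ) renaming (_≟_ to _≟ᶠ_)
open import Data.Fin.Subset using (Subset; ⁅_⁆; _∩_; _∪_; _─_; ∣_∣; inside; outside) renaming (⊤ to fullSet)
open import Data.Vec using (Vec; []; _∷_; lookup)
open import Data.Vec.Properties using (≡-dec)
open import Data.List using (List; []; _∷_; [_]; map; _++_; concatMap; foldr; length; allFin)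
open import Data.List.Relation.Unary.Unique.Propositional using (Unique)
open import Data.Product using (Σ; _×_; _,_)
open import Data.Unit using (⊤)
open import Data.Empty using (⊥)
open import Relation.Nullary using (¬_; does)
import Data.Bool as B
open import Algebra.Bundles using (CommutativeRing)

anyL : {A : Set} → (A → Bool) → List A → Bool
anyL p = foldr (λ x b → p x ∨ b) false

allL : {A : Set} → (A → Bool) → List A → Bool
allL p = foldr (λ x b → p x ∧ b) true

filterB : {A : Set} → (A → Bool) → List A → List A
filterB p [] = []
filterB p (x ∷ xs) = if p x then x ∷ filterB p xs else filterB p xs

anyFin : ∀ {n} → (Fin n → Bool) → Bool
anyFin {n} p = anyL p (allFin n)

allFin? : ∀ {n} → (Fin n → Bool) → Bool
allFin? {n} p = allL p (allFin n)

countFin : ∀ {n} → (Fin n → Bool) → ℕ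
countFin {n} p = length (filterB p (allFin n))

_==ᶠ_ : ∀ {n} → Fin n → Fin n → Bool
i ==ᶠ j = does (i ≟ᶠ j)

_==ˢ_ : ∀ {n} → Subset n → Subset n → Bool
X ==ˢ Y = does (≡-dec B._≟_ X Y)

_⊆ᵇ_ : ∀ {n} → Subset n → Subset n → Bool
X ⊆ᵇ Y = allFin? (λ i → not (lookup X i) ∨ lookup Y i)

allSubsets : ∀ n → List (Subset n)
allSubsets zero = [ [] ]
allSubsets (suc n) = map (outside ∷_) (allSubsets n) ++ map (inside ∷_) (allSubsets n)

-- Simplicial complexes on the ambient vertex set Fin n, given by their
-- (decidable) face predicate.

Complex : ℕ → Set
Complex n = Subset n → Bool

restrict : ∀ {n} → Complex n → Subset n → Complex n
restrict {n} Γ W Y = anyL (λ X → Γ X ∧ ((X ∩ W) ==ˢ Y)) (allSubsets n)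

-- dim Γ < s  ⇔  every face X satisfies |X| - 1 < s, i.e. |X| ≤ s
dimLess : ∀ {n} → ℕ → Complex n → Bool
dimLess {n} s Γ = allL (λ X → not (Γ X) ∨ (∣ X ∣ ≤ᵇ s)) (allSubsets n)

skEdge : ∀ {n} → Complex n → Fin n → Fin n → Bool
skEdge Δ u v = not (u ==ᶠ v) ∧ Δ (⁅ u ⁆ ∪ ⁅ v ⁆)

reach : ∀ {n} → Complex n → Subset n → ℕ → Fin n → Fin n → Bool
reach Δ W zero u v = lookup W u ∧ (u ==ᶠ v)
reach Δ W (suc k) u v =
  reach Δ W k u v ∨ anyFin (λ w → reach Δ W k u w ∧ lookup W v ∧ skEdge Δ w v)

-- number of connected components of the 1-skeleton (vertex set W):
-- count vertices that are the smallest vertex of their component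
components : ∀ {n} → Complex n → Subset n → ℕ
components {n} Δ W =
  countFin (λ v → lookup W v ∧ not (anyFin (λ w → (toℕ w <ᵇ toℕ v) ∧ reach Δ W n w v)))

rk1 : ∀ {n} → Complex n → Subset n → ℕ
rk1 Δ W = ∣ W ∣ ∸ components Δ W

extendComp : List ℕ → List (List ℕ)
extendComp [] = [ 1 ∷ [] ]
extendComp (a ∷ α) = (1 ∷ a ∷ α) ∷ (suc a ∷ α) ∷ []

compositions : ℕ → List (List ℕ)
compositions zero = [ [] ]
compositions (suc n) = concatMap extendComp (compositions n)

subsetsOfSize : ∀ {n} → ℕ → Subset n → List (Subset n)
subsetsOfSize {n} a rem = filterB (λ Bl → (∣ Bl ∣ ==ℕ a) ∧ (Bl ⊆ᵇ rem)) (allSubsets n)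

orderedSetPartitions : ∀ {n} → List ℕ → Subset n → List (List (Subset n))
orderedSetPartitions [] rem = if ∣ rem ∣ ==ℕ 0 then [ [] ] else []
orderedSetPartitions (a ∷ α) rem =
  concatMap (λ Bl → map (Bl ∷_) (orderedSetPartitions α (rem ─ Bl))) (subsetsOfSize a rem)

falling : ℤ → ℕ → ℤ
falling t zero = + 1
falling t (suc k) = falling t k *ℤ (t -ℤ + k)

binomℤ : ℤ → ℕ → ℤ
binomℤ t k = _/ℕ_ (falling t k) (k !) {{k !≢0}}

module _ {c ℓ : Level} (R : CommutativeRing c ℓ) where
  open CommutativeRing R

  pow : Carrier → ℕ → Carrier
  pow x zero = 1#
  pow x (suc k) = x * pow x k

  natR : ℕ → Carrier
  natR zero = 0#
  natR (suc k) = 1# + natR k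

  intR : ℤ → Carrier
  intR (+ k) = natR k
  intR -[1+ k ] = - natR (suc k)

  sumR : List Carrier → Carrier
  sumR = foldr _+_ 0#

  prodR : List Carrier → Carrier
  prodR = foldr _*_ 1#

  zetaq : Carrier → ℕ → ∀ {n} → Complex n → Subset n → Carrier
  zetaq q s Δ W = if dimLess s Δ then pow q (rk1 Δ W) else 0#

  zetaMinusq : Carrier → ℕ → ∀ {n} → Complex n → Subset n → Carrier
  zetaMinusq q s = zetaq (- q) s

  -- Ψ_{ζ_{s,-q}}(Γ), a homogeneous quasisymmetric function of degree n,
  -- represented by its coefficient function α ↦ [M_α]
  Psi : Carrier → ℕ → ∀ {n} → Complex n → List ℕ → Carrier
  Psi q s {n} Γ α =
    sumR (map (λ P → prodR (map (λ Vj → zetaMinusq q s (restrict Γ Vj) Vj) P))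
              (orderedSetPartitions α (fullSet {n})))

  ps1At : ℕ → (List ℕ → Carrier) → ℤ → Carrier
  ps1At n g t = sumR (map (λ α → g α * intR (binomℤ t (length α))) (compositions n))

module _ {n : ℕ} (Adj : Fin n → Fin n → Bool) where

  data Walk : Fin n → Fin n → Set where
    here : ∀ {u} → Walk u u
    step : ∀ {u v w} → T (Adj u v) → Walk v w → Walk u w

  Chain : List (Fin n) → Set
  Chain [] = ⊤
  Chain (a ∷ []) = ⊤
  Chain (a ∷ b ∷ l) = T (Adj a b) × Chain (b ∷ l)

  IsCycle : List (Fin n) → Set
  IsCycle [] = ⊥
  IsCycle (x ∷ xs) = (2 ≤ length xs) × Unique (x ∷ xs) × Chain (x ∷ xs ++ [ x ])

  record IsTree : Set where
    field
      symmetric   : ∀ u v → T (Adj u v) → T (Adj v u)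
      irreflexive : ∀ u → ¬ T (Adj u u)
      connected   : ∀ u v → Walk u v
      acyclic     : ∀ l → ¬ IsCycle l

graphComplex : ∀ {n} → (Fin n → Fin n → Bool) → Complex n
graphComplex Adj X =
  (∣ X ∣ ≤ᵇ 1) ∨ anyFin (λ u → anyFin (λ v → Adj u v ∧ not (u ==ᶠ v) ∧ (X ==ˢ (⁅ u ⁆ ∪ ⁅ v ⁆))))

module Submission where

-- Every restriction T_B of the tree is a forest of dimension ≤ 1 < s, so ζ_{s,-q}(T_B) = (-q)^{rk B},
-- and binom(-1, k) = (-1)^k. Hence the left-hand side is K(V), where
-- K(W) = Σ_α (-1)^{ℓ(α)} Σ_{(V_1,…,V_k)} Π_j ζ(V_j) with (V_1,…,V_k) running over the ordered set
-- partitions of W of type α. Splitting off the first block gives K(W) = -Σ_{∅≠B⊆W} ζ(B) K(W∖B),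
-- and by induction on |W| this yields K(W) = (-1)^{|W|} (q+2)^{rk W}, provided that
--   Σ_{B⊆W} (-1)^{|B|} (-q)^{rk B} (q+2)^{rk(W∖B)} = 0   for every nonempty W.
-- For the latter take a vertex v of degree ≤ 1 in the forest T_W and pair each B ∌ v with B ∪ {v}.
-- Removing v from the side containing its neighbour u lowers the rank by one, removing it from the
-- other side (where it is isolated) does not change the rank; so each pair contributes (q + 1),
-- or 0 if v has no neighbour, times the corresponding summand for W∖{v}, and the sum vanishes by
-- induction. Finally rk V = n - 1 because the tree is connected.

open import Defs
open import Level using (Level)
open import Data.Bool using (Bool; true; false; _∧_; _∨_; not; T; if_then_else_)
open import Data.Bool.Properties using (∧-identityʳ; ∧-zeroʳ; ∨-identityʳ; ¬-not; T-≡)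
import Data.Bool as Bool
open import Data.Nat using (ℕ; zero; suc; _∸_; _≤_; _<_; z≤n; s≤s; _≤ᵇ_; _<ᵇ_; _!; NonZero)
open import Data.Nat.Base using () renaming (_≡ᵇ_ to _==ℕ_)
import Data.Nat.Properties as ℕ
open import Data.Integer using (-[1+_])
open import Data.Fin using (Fin; zero; suc; toℕ; _≟_; fromℕ<)
import Data.Fin.Properties as Fin
open import Data.Fin.Subset using (Subset; ⁅_⁆; _∩_; _∪_; _─_; ∣_∣) renaming (⊤ to full; ⊥ to empty)
import Data.Fin.Subset.Properties as Subset
open import Data.Vec using ([]; _∷_; lookup)
import Data.Vec.Properties as Vec
open import Data.List using (List; []; _∷_; [_]; map; _++_; concatMap; length; allFin; tabulate)
import Data.List.Properties as List
open import Data.List.Membership.Propositional using (_∈_)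
open import Data.List.Membership.Propositional.Properties using (∈-allFin; ∈-map⁺; ∈-++⁺ˡ; ∈-++⁺ʳ; ∈-∃++)
import Data.List.Membership.DecPropositional as DecMembership
open import Data.List.Relation.Unary.Any using (here; there)
open import Data.List.Relation.Unary.All using (All; []; _∷_)
open import Data.List.Relation.Unary.All.Properties using (¬Any⇒All¬; ++⁻ˡ)
open import Data.List.Relation.Unary.AllPairs using ([]; _∷_)
open import Data.List.Relation.Unary.Unique.Propositional using (Unique)
open import Data.Product using (_×_; _,_; ∃; proj₁; proj₂)
open import Data.Sum using (_⊎_; inj₁; inj₂)
open import Data.Empty using (⊥; ⊥-elim)
open import Data.Unit using (tt)
open import Function using (_∘_; Equivalence)
open import Relation.Nullary using (¬_; yes; no)
open import Relation.Binary.Definitions using (tri<; tri≈; tri>)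
import Relation.Binary.PropositionalEquality as ≡
open ≡ using (_≡_)
open import Algebra.Bundles using (CommutativeRing)

module Combinatorics where

  open import Data.Nat using (_+_)
  open ≡ using (refl; sym; trans; cong; cong₂; subst; module ≡-Reasoning)

  ∧-elimˡ : ∀ {a b} → a ∧ b ≡ true → a ≡ true
  ∧-elimˡ {true} _ = refl

  ∧-elimʳ : ∀ {a b} → a ∧ b ≡ true → b ≡ true
  ∧-elimʳ {true} e = e

  ∧-intro : ∀ {a b} → a ≡ true → b ≡ true → a ∧ b ≡ true
  ∧-intro refl refl = refl

  ∨-elim : ∀ {a b} → a ∨ b ≡ true → a ≡ true ⊎ b ≡ true
  ∨-elim {true} _ = inj₁ refl
  ∨-elim {false} e = inj₂ e

  ∨-introˡ : ∀ {a b} → a ≡ true → a ∨ b ≡ true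
  ∨-introˡ refl = refl

  ∨-introʳ : ∀ {a b} → b ≡ true → a ∨ b ≡ true
  ∨-introʳ {true} _ = refl
  ∨-introʳ {false} e = e

  not-elim : ∀ {a} → not a ≡ true → a ≡ false
  not-elim {false} _ = refl

  not-intro : ∀ {a} → a ≡ false → not a ≡ true
  not-intro refl = refl

  not-∨-false : ∀ {a b} → not a ∨ b ≡ false → a ≡ true × b ≡ false
  not-∨-false {true} {false} _ = refl , refl

  ≡true⇒≢false : ∀ {a} → a ≡ true → ¬ (a ≡ false)
  ≡true⇒≢false refl ()

  bool-ext : ∀ {a b} → (a ≡ true → b ≡ true) → (b ≡ true → a ≡ true) → a ≡ b
  bool-ext {true} {true} _ _ = refl
  bool-ext {true} {false} f _ = sym (f refl)
  bool-ext {false} {true} _ g = g refl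
  bool-ext {false} {false} _ _ = refl

  anyL-witness : ∀ {A : Set} (p : A → Bool) xs → anyL p xs ≡ true → ∃ λ x → x ∈ xs × p x ≡ true
  anyL-witness p (x ∷ xs) e with ∨-elim {p x} e
  ... | inj₁ h = x , here refl , h
  ... | inj₂ h with anyL-witness p xs h
  ...   | y , y∈xs , py = y , there y∈xs , py

  anyL-intro : ∀ {A : Set} (p : A → Bool) {xs x} → x ∈ xs → p x ≡ true → anyL p xs ≡ true
  anyL-intro p (here refl) h = ∨-introˡ h
  anyL-intro p {y ∷ _} (there x∈xs) h = ∨-introʳ {p y} (anyL-intro p x∈xs h)

  allL-intro : ∀ {A : Set} (p : A → Bool) xs → (∀ x → p x ≡ true) → allL p xs ≡ true
  allL-intro p [] h = refl
  allL-intro p (x ∷ xs) h = ∧-intro (h x) (allL-intro p xs h)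

  allL-elim : ∀ {A : Set} (p : A → Bool) {xs x} → allL p xs ≡ true → x ∈ xs → p x ≡ true
  allL-elim p {y ∷ _} h (here refl) = ∧-elimˡ h
  allL-elim p {y ∷ _} h (there x∈xs) = allL-elim p (∧-elimʳ {p y} h) x∈xs

  anyFin-witness : ∀ {n} (p : Fin n → Bool) → anyFin p ≡ true → ∃ λ i → p i ≡ true
  anyFin-witness {n} p e with anyL-witness p (allFin n) e
  ... | i , _ , pi = i , pi

  anyFin-intro : ∀ {n} (p : Fin n → Bool) i → p i ≡ true → anyFin p ≡ true
  anyFin-intro p i = anyL-intro p (∈-allFin i)

  anyFin-false : ∀ {n} (p : Fin n → Bool) → (∀ i → ¬ (p i ≡ true)) → anyFin p ≡ false
  anyFin-false p h = ¬-not λ e → let (i , pi) = anyFin-witness p e in h i pi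

  allFin?-elim : ∀ {n} (p : Fin n → Bool) → allFin? p ≡ true → ∀ i → p i ≡ true
  allFin?-elim {n} p h i = allL-elim p h (∈-allFin i)

  allFin?-false : ∀ {n} (p : Fin n → Bool) → allFin? p ≡ false → ∃ λ i → p i ≡ false
  allFin?-false {n} p h = go (allFin n) h
    where
    go : ∀ xs → allL p xs ≡ false → ∃ λ i → p i ≡ false
    go (x ∷ xs) e with p x in px
    ... | true = go xs e
    ... | false = x , px

  ==ᶠ⇒≡ : ∀ {n} {i j : Fin n} → (i ==ᶠ j) ≡ true → i ≡ j
  ==ᶠ⇒≡ {i = i} {j} e with i ≟ j
  ... | yes i≡j = i≡j

  ≡⇒==ᶠ : ∀ {n} {i j : Fin n} → i ≡ j → (i ==ᶠ j) ≡ true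
  ≡⇒==ᶠ {i = i} {j} i≡j with i ≟ j
  ... | yes _ = refl
  ... | no i≢j = ⊥-elim (i≢j i≡j)

  ≢⇒==ᶠfalse : ∀ {n} {i j : Fin n} → ¬ (i ≡ j) → (i ==ᶠ j) ≡ false
  ≢⇒==ᶠfalse i≢j = ¬-not (i≢j ∘ ==ᶠ⇒≡)

  ∧-not-==ᶠ-refl : ∀ {n} b (i : Fin n) → b ∧ not (i ==ᶠ i) ≡ false
  ∧-not-==ᶠ-refl b i rewrite ≡⇒==ᶠ {i = i} refl = ∧-zeroʳ b

  ∧-not-==ᶠ-≢ : ∀ {n} b {i j : Fin n} → ¬ (i ≡ j) → b ∧ not (i ==ᶠ j) ≡ b
  ∧-not-==ᶠ-≢ b i≢j rewrite ≢⇒==ᶠfalse i≢j = ∧-identityʳ b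

  fromBool : Bool → ℕ
  fromBool true = 1
  fromBool false = 0

  count : ∀ {n} → (Fin n → Bool) → ℕ
  count {zero} p = 0
  count {suc n} p = fromBool (p zero) + count (p ∘ suc)

  countFin≡count : ∀ {n} (p : Fin n → Bool) → countFin p ≡ count p
  countFin≡count p = go p (λ i → i)
    where
    go : ∀ {A : Set} {n} (p : A → Bool) (f : Fin n → A) →
         length (filterB p (tabulate f)) ≡ count (p ∘ f)
    go {n = zero} p f = refl
    go {n = suc n} p f with p (f zero)
    ... | true = cong suc (go p (f ∘ suc))
    ... | false = go p (f ∘ suc)

  count-cong : ∀ {n} {p p′ : Fin n → Bool} → (∀ i → p i ≡ p′ i) → count p ≡ count p′
  count-cong {zero} h = refl
  count-cong {suc n} h = cong₂ _+_ (cong fromBool (h zero)) (count-cong (h ∘ suc))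

  count≤n : ∀ {n} (p : Fin n → Bool) → count p ≤ n
  count≤n {zero} p = z≤n
  count≤n {suc n} p with p zero
  ... | true = s≤s (count≤n (p ∘ suc))
  ... | false = ℕ.m≤n⇒m≤1+n (count≤n (p ∘ suc))

  count-mono : ∀ {n} {p p′ : Fin n → Bool} → (∀ i → p i ≡ true → p′ i ≡ true) → count p ≤ count p′
  count-mono {zero} h = z≤n
  count-mono {suc n} {p} {p′} h with p zero in e | p′ zero in e′
  ... | true | true = s≤s (count-mono (h ∘ suc))
  ... | true | false = ⊥-elim (≡true⇒≢false (h zero e) e′)
  ... | false | true = ℕ.m≤n⇒m≤1+n (count-mono (h ∘ suc))
  ... | false | false = count-mono (h ∘ suc)

  count-mono-< : ∀ {n} {p p′ : Fin n → Bool} → (∀ i → p i ≡ true → p′ i ≡ true) →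
                 ∀ j → p j ≡ false → p′ j ≡ true → count p < count p′
  count-mono-< {suc n} {p} {p′} h zero pj p′j rewrite pj | p′j = s≤s (count-mono (h ∘ suc))
  count-mono-< {suc n} {p} {p′} h (suc j) pj p′j with p zero in e | p′ zero in e′
  ... | true | true = s≤s (count-mono-< (h ∘ suc) j pj p′j)
  ... | true | false = ⊥-elim (≡true⇒≢false (h zero e) e′)
  ... | false | true = ℕ.m≤n⇒m≤1+n (count-mono-< (h ∘ suc) j pj p′j)
  ... | false | false = count-mono-< (h ∘ suc) j pj p′j

  count-remove : ∀ {n} (p : Fin n → Bool) (x : Fin n) →
                 count p ≡ count (λ i → p i ∧ not (i ==ᶠ x)) + fromBool (p x)
  count-remove {suc n} p zero = begin
    fromBool (p zero) + count (p ∘ suc)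
      ≡⟨ ℕ.+-comm (fromBool (p zero)) _ ⟩
    count (p ∘ suc) + fromBool (p zero)
      ≡⟨ cong₂ (λ a c → fromBool a + c + fromBool (p zero)) (sym (∧-zeroʳ (p zero)))
               (count-cong (sym ∘ ∧-identityʳ ∘ p ∘ suc)) ⟩
    fromBool (p zero ∧ false) + count (λ i → p (suc i) ∧ true) + fromBool (p zero) ∎
    where open ≡-Reasoning
  count-remove {suc n} p (suc x) = begin
    fromBool (p zero) + count (p ∘ suc)
      ≡⟨ cong (fromBool (p zero) +_) (count-remove (p ∘ suc) x) ⟩
    fromBool (p zero) + (count (λ i → p (suc i) ∧ not (i ==ᶠ x)) + fromBool (p (suc x)))
      ≡⟨ sym (ℕ.+-assoc (fromBool (p zero)) _ _) ⟩
    fromBool (p zero) + count (λ i → p (suc i) ∧ not (i ==ᶠ x)) + fromBool (p (suc x))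
      ≡⟨ cong (λ a → fromBool a + count (λ i → p (suc i) ∧ not (i ==ᶠ x)) + fromBool (p (suc x)))
              (sym (∧-identityʳ (p zero))) ⟩
    fromBool (p zero ∧ true) + count (λ i → p (suc i) ∧ not (i ==ᶠ x)) + fromBool (p (suc x)) ∎
    where open ≡-Reasoning

  count-exchange : ∀ {n} (p p′ : Fin n → Bool) x y →
                   (∀ i → p i ∧ not (i ==ᶠ x) ≡ p′ i ∧ not (i ==ᶠ y)) →
                   count p + fromBool (p′ y) ≡ count p′ + fromBool (p x)
  count-exchange p p′ x y off = begin
    count p + fromBool (p′ y)
      ≡⟨ cong (_+ fromBool (p′ y)) (count-remove p x) ⟩
    count (λ i → p i ∧ not (i ==ᶠ x)) + fromBool (p x) + fromBool (p′ y)
      ≡⟨ ℕ.+-assoc (count (λ i → p i ∧ not (i ==ᶠ x))) (fromBool (p x)) _ ⟩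
    count (λ i → p i ∧ not (i ==ᶠ x)) + (fromBool (p x) + fromBool (p′ y))
      ≡⟨ cong₂ _+_ (count-cong off) (ℕ.+-comm (fromBool (p x)) _) ⟩
    count (λ i → p′ i ∧ not (i ==ᶠ y)) + (fromBool (p′ y) + fromBool (p x))
      ≡⟨ sym (ℕ.+-assoc (count (λ i → p′ i ∧ not (i ==ᶠ y))) (fromBool (p′ y)) _) ⟩
    count (λ i → p′ i ∧ not (i ==ᶠ y)) + fromBool (p′ y) + fromBool (p x)
      ≡⟨ cong (_+ fromBool (p x)) (sym (count-remove p′ y)) ⟩
    count p′ + fromBool (p x) ∎
    where open ≡-Reasoning

  count-false : ∀ {n} (p : Fin n → Bool) → (∀ i → p i ≡ false) → count p ≡ 0
  count-false {zero} p h = refl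
  count-false {suc n} p h rewrite h zero = count-false (p ∘ suc) (h ∘ suc)

  count-witness : ∀ {n} (p : Fin n → Bool) → 1 ≤ count p → ∃ λ i → p i ≡ true
  count-witness {suc n} p h with p zero in e
  ... | true = zero , e
  ... | false with count-witness (p ∘ suc) h
  ...   | i , pi = suc i , pi

  1≤count : ∀ {n} (p : Fin n → Bool) i → p i ≡ true → 1 ≤ count p
  1≤count p i pi = ℕ.≤-trans (ℕ.≤-reflexive (cong fromBool (sym pi))) (lemma p i)
    where
    lemma : ∀ {n} (p : Fin n → Bool) i → fromBool (p i) ≤ count p
    lemma p zero = ℕ.m≤m+n _ _
    lemma p (suc i) = ℕ.≤-trans (lemma (p ∘ suc) i) (ℕ.m≤n+m _ _)

  2≤count : ∀ {n} (p : Fin n → Bool) i j → ¬ (i ≡ j) → p i ≡ true → p j ≡ true → 2 ≤ count p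
  2≤count p i j i≢j pi pj rewrite count-remove p i | pi =
    ℕ.≤-trans (s≤s (1≤count _ j (∧-intro pj (not-intro (≢⇒==ᶠfalse (i≢j ∘ sym)))))) (ℕ.≤-reflexive (ℕ.+-comm 1 _))

  least-true : ∀ {n} (p : Fin n → Bool) i → p i ≡ true →
               ∃ λ m → p m ≡ true × (∀ j → p j ≡ true → toℕ m ≤ toℕ j)
  least-true {suc n} p i pi with p zero in e
  ... | true = zero , e , λ _ _ → z≤n
  least-true {suc n} p zero pi | false = ⊥-elim (≡true⇒≢false pi e)
  least-true {suc n} p (suc i) pi | false with least-true (p ∘ suc) i pi
  ... | m , pm , minimal = suc m , pm , minimal′
    where
    minimal′ : ∀ j → p j ≡ true → toℕ (suc m) ≤ toℕ j
    minimal′ zero pj = ⊥-elim (≡true⇒≢false pj e)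
    minimal′ (suc j) pj = s≤s (minimal j pj)

  infix 4 _∈ₛ_ _∉ₛ_ _⊆_

  _∈ₛ_ _∉ₛ_ : ∀ {n} → Fin n → Subset n → Set
  i ∈ₛ X = lookup X i ≡ true
  i ∉ₛ X = lookup X i ≡ false

  _⊆_ : ∀ {n} → Subset n → Subset n → Set
  X ⊆ Y = ∀ i → i ∈ₛ X → i ∈ₛ Y

  subset-ext : ∀ {n} (X Y : Subset n) → (∀ i → lookup X i ≡ lookup Y i) → X ≡ Y
  subset-ext X Y h = trans (sym (Vec.tabulate∘lookup X)) (trans (Vec.tabulate-cong h) (Vec.tabulate∘lookup Y))

  lookup-∩ : ∀ {n} (X Y : Subset n) i → lookup (X ∩ Y) i ≡ lookup X i ∧ lookup Y i
  lookup-∩ X Y i = Vec.lookup-zipWith _∧_ i X Y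

  lookup-∪ : ∀ {n} (X Y : Subset n) i → lookup (X ∪ Y) i ≡ lookup X i ∨ lookup Y i
  lookup-∪ X Y i = Vec.lookup-zipWith _∨_ i X Y

  lookup-─ : ∀ {n} (X Y : Subset n) i → lookup (X ─ Y) i ≡ lookup X i ∧ not (lookup Y i)
  lookup-─ (x ∷ X) (true ∷ Y) zero = sym (∧-zeroʳ x)
  lookup-─ (x ∷ X) (false ∷ Y) zero = sym (∧-identityʳ x)
  lookup-─ (x ∷ X) (true ∷ Y) (suc i) = lookup-─ X Y i
  lookup-─ (x ∷ X) (false ∷ Y) (suc i) = lookup-─ X Y i

  lookup-full : ∀ {n} (i : Fin n) → lookup full i ≡ true
  lookup-full i = Vec.lookup-replicate i true

  lookup-empty : ∀ {n} (i : Fin n) → i ∉ₛ empty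
  lookup-empty i = Vec.lookup-replicate i false

  lookup-⁅⁆ : ∀ {n} (x i : Fin n) → lookup ⁅ x ⁆ i ≡ (i ==ᶠ x)
  lookup-⁅⁆ zero zero = refl
  lookup-⁅⁆ zero (suc i) = lookup-empty i
  lookup-⁅⁆ (suc x) zero = refl
  lookup-⁅⁆ (suc x) (suc i) = lookup-⁅⁆ x i

  ∣p∣≡count : ∀ {n} (X : Subset n) → ∣ X ∣ ≡ count (lookup X)
  ∣p∣≡count [] = refl
  ∣p∣≡count (true ∷ X) = cong suc (∣p∣≡count X)
  ∣p∣≡count (false ∷ X) = ∣p∣≡count X

  ==ˢ⇒≡ : ∀ {n} {X Y : Subset n} → (X ==ˢ Y) ≡ true → X ≡ Y
  ==ˢ⇒≡ {X = X} {Y} e with Vec.≡-dec Bool._≟_ X Y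
  ... | yes X≡Y = X≡Y

  ≡⇒==ˢ : ∀ {n} {X Y : Subset n} → X ≡ Y → (X ==ˢ Y) ≡ true
  ≡⇒==ˢ {X = X} {Y} X≡Y with Vec.≡-dec Bool._≟_ X Y
  ... | yes _ = refl
  ... | no X≢Y = ⊥-elim (X≢Y X≡Y)

  ∈-allSubsets : ∀ {n} (X : Subset n) → X ∈ allSubsets n
  ∈-allSubsets [] = here refl
  ∈-allSubsets {suc n} (false ∷ X) = ∈-++⁺ˡ (∈-map⁺ (false ∷_) (∈-allSubsets X))
  ∈-allSubsets {suc n} (true ∷ X) = ∈-++⁺ʳ (map (false ∷_) (allSubsets n)) (∈-map⁺ (true ∷_) (∈-allSubsets X))

  ⊆ᵇ⇒⊆ : ∀ {n} (X Y : Subset n) → (X ⊆ᵇ Y) ≡ true → X ⊆ Y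
  ⊆ᵇ⇒⊆ X Y h i Xi with ∨-elim {not (lookup X i)} (allFin?-elim _ h i)
  ... | inj₁ k = ⊥-elim (≡true⇒≢false Xi (not-elim k))
  ... | inj₂ k = k

  ⊆⇒⊆ᵇ : ∀ {n} (X Y : Subset n) → X ⊆ Y → (X ⊆ᵇ Y) ≡ true
  ⊆⇒⊆ᵇ {n} X Y X⊆Y = allL-intro _ (allFin n) pointwise
    where
    pointwise : ∀ i → (not (lookup X i) ∨ lookup Y i) ≡ true
    pointwise i with lookup X i in Xi
    ... | true = X⊆Y i Xi
    ... | false = refl

  ∣p∪q∣≤∣p∣+∣q∣ : ∀ {n} (X Y : Subset n) → ∣ X ∪ Y ∣ ≤ ∣ X ∣ + ∣ Y ∣
  ∣p∪q∣≤∣p∣+∣q∣ [] [] = z≤n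
  ∣p∪q∣≤∣p∣+∣q∣ (true ∷ X) (y ∷ Y) =
    s≤s (ℕ.≤-trans (∣p∪q∣≤∣p∣+∣q∣ X Y) (ℕ.+-monoʳ-≤ ∣ X ∣ (Subset.∣p∣≤∣x∷p∣ y Y)))
  ∣p∪q∣≤∣p∣+∣q∣ (false ∷ X) (true ∷ Y) =
    ℕ.≤-trans (s≤s (∣p∪q∣≤∣p∣+∣q∣ X Y)) (ℕ.≤-reflexive (sym (ℕ.+-suc ∣ X ∣ ∣ Y ∣)))
  ∣p∪q∣≤∣p∣+∣q∣ (false ∷ X) (false ∷ Y) = ∣p∪q∣≤∣p∣+∣q∣ X Y

  ∣p─q∣+∣q∣≡∣p∣ : ∀ {n} (X Y : Subset n) → Y ⊆ X → ∣ X ─ Y ∣ + ∣ Y ∣ ≡ ∣ X ∣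
  ∣p─q∣+∣q∣≡∣p∣ [] [] _ = refl
  ∣p─q∣+∣q∣≡∣p∣ (x ∷ X) (true ∷ Y) Y⊆X with Y⊆X zero refl
  ... | refl = trans (ℕ.+-suc _ _) (cong suc (∣p─q∣+∣q∣≡∣p∣ X Y (Y⊆X ∘ suc)))
  ∣p─q∣+∣q∣≡∣p∣ (true ∷ X) (false ∷ Y) Y⊆X = cong suc (∣p─q∣+∣q∣≡∣p∣ X Y (Y⊆X ∘ suc))
  ∣p─q∣+∣q∣≡∣p∣ (false ∷ X) (false ∷ Y) Y⊆X = ∣p─q∣+∣q∣≡∣p∣ X Y (Y⊆X ∘ suc)

  p⊆q⇒p∩q≡p : ∀ {n} {X Y : Subset n} → X ⊆ Y → X ∩ Y ≡ X
  p⊆q⇒p∩q≡p {X = X} {Y} X⊆Y = subset-ext _ _ pointwise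
    where
    pointwise : ∀ i → lookup (X ∩ Y) i ≡ lookup X i
    pointwise i rewrite lookup-∩ X Y i with lookup X i in Xi
    ... | true = X⊆Y i Xi
    ... | false = refl

  p─q⊆p : ∀ {n} (X Y : Subset n) → X ─ Y ⊆ X
  p─q⊆p X Y i h = ∧-elimˡ (trans (sym (lookup-─ X Y i)) h)

  lookup-─⁅⁆ : ∀ {n} (X : Subset n) v i → lookup (X ─ ⁅ v ⁆) i ≡ lookup X i ∧ not (i ==ᶠ v)
  lookup-─⁅⁆ X v i = trans (lookup-─ X ⁅ v ⁆ i) (cong (λ b → lookup X i ∧ not b) (lookup-⁅⁆ v i))

  x∉p─⁅x⁆ : ∀ {n} (X : Subset n) v → v ∉ₛ X ─ ⁅ v ⁆
  x∉p─⁅x⁆ X v = trans (lookup-─⁅⁆ X v v) (∧-not-==ᶠ-refl (lookup X v) v)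

  lookup-─⁅⁆-≢ : ∀ {n} (X : Subset n) {v i} → ¬ (i ≡ v) → lookup (X ─ ⁅ v ⁆) i ≡ lookup X i
  lookup-─⁅⁆-≢ X {v} {i} i≢v = trans (lookup-─⁅⁆ X v i) (∧-not-==ᶠ-≢ (lookup X i) i≢v)

  ∣p∣≡1+∣p─⁅x⁆∣ : ∀ {n} (X : Subset n) {v} → v ∈ₛ X → ∣ X ∣ ≡ suc ∣ X ─ ⁅ v ⁆ ∣
  ∣p∣≡1+∣p─⁅x⁆∣ X {v} v∈X = begin
    ∣ X ∣                         ≡⟨ sym (∣p─q∣+∣q∣≡∣p∣ X ⁅ v ⁆ ⁅v⁆⊆X) ⟩
    ∣ X ─ ⁅ v ⁆ ∣ + ∣ ⁅ v ⁆ ∣     ≡⟨ cong (∣ X ─ ⁅ v ⁆ ∣ +_) (Subset.∣⁅x⁆∣≡1 v) ⟩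
    ∣ X ─ ⁅ v ⁆ ∣ + 1             ≡⟨ ℕ.+-comm _ 1 ⟩
    suc ∣ X ─ ⁅ v ⁆ ∣             ∎
    where
    open ≡-Reasoning
    ⁅v⁆⊆X : ⁅ v ⁆ ⊆ X
    ⁅v⁆⊆X i i∈⁅v⁆ rewrite ==ᶠ⇒≡ {i = i} {v} (trans (sym (lookup-⁅⁆ v i)) i∈⁅v⁆) = v∈X

  p∪⁅x⁆─⁅x⁆≡p : ∀ {n} (B : Subset n) {v} → v ∉ₛ B → (B ∪ ⁅ v ⁆) ─ ⁅ v ⁆ ≡ B
  p∪⁅x⁆─⁅x⁆≡p B {v} v∉B = subset-ext _ _ pointwise
    where
    pointwise : ∀ i → lookup ((B ∪ ⁅ v ⁆) ─ ⁅ v ⁆) i ≡ lookup B i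
    pointwise i rewrite lookup-─⁅⁆ (B ∪ ⁅ v ⁆) v i | lookup-∪ B ⁅ v ⁆ i | lookup-⁅⁆ v i with i ≟ v
    ... | yes refl = trans (∧-zeroʳ _) (sym v∉B)
    ... | no _ = trans (∧-identityʳ _) (∨-identityʳ _)

  p─[q∪⁅x⁆]≡p─⁅x⁆─q : ∀ {n} (W B : Subset n) v → W ─ (B ∪ ⁅ v ⁆) ≡ (W ─ ⁅ v ⁆) ─ B
  p─[q∪⁅x⁆]≡p─⁅x⁆─q W B v = trans (cong (W ─_) (Subset.∪-comm B ⁅ v ⁆)) (sym (Subset.p─q─r≡p─q∪r W ⁅ v ⁆ B))

  p─q─⁅x⁆≡p─⁅x⁆─q : ∀ {n} (W B : Subset n) v → (W ─ B) ─ ⁅ v ⁆ ≡ (W ─ ⁅ v ⁆) ─ B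
  p─q─⁅x⁆≡p─⁅x⁆─q W B v = trans (Subset.p─q─r≡p─q∪r W B ⁅ v ⁆) (p─[q∪⁅x⁆]≡p─⁅x⁆─q W B v)

  x∈p∪⁅y⁆⁻ : ∀ {n} (B : Subset n) {v i} → i ∈ₛ B ∪ ⁅ v ⁆ → i ∈ₛ B ⊎ i ≡ v
  x∈p∪⁅y⁆⁻ B {v} {i} h with ∨-elim {lookup B i} (trans (sym (lookup-∪ B ⁅ v ⁆ i)) h)
  ... | inj₁ i∈B = inj₁ i∈B
  ... | inj₂ i∈⁅v⁆ = inj₂ (==ᶠ⇒≡ (trans (sym (lookup-⁅⁆ v i)) i∈⁅v⁆))

  x∈p⇒x∈p∪⁅y⁆ : ∀ {n} (B : Subset n) {v i} → i ∈ₛ B → i ∈ₛ B ∪ ⁅ v ⁆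
  x∈p⇒x∈p∪⁅y⁆ B {v} {i} i∈B = trans (lookup-∪ B ⁅ v ⁆ i) (∨-introˡ i∈B)

  x∈p∪⁅x⁆ : ∀ {n} (B : Subset n) v → v ∈ₛ B ∪ ⁅ v ⁆
  x∈p∪⁅x⁆ B v = trans (lookup-∪ B ⁅ v ⁆ v) (∨-introʳ {lookup B v} (trans (lookup-⁅⁆ v v) (≡⇒==ᶠ {i = v} refl)))

  x∈p⇒x∉q⇒x∈p─q : ∀ {n} (W B : Subset n) {i} → i ∈ₛ W → i ∉ₛ B → i ∈ₛ W ─ B
  x∈p⇒x∉q⇒x∈p─q W B {i} i∈W i∉B = trans (lookup-─ W B i) (cong₂ (λ a b → a ∧ not b) i∈W i∉B)

  x∈q⇒x∉p─q : ∀ {n} (W B : Subset n) {i} → i ∈ₛ B → i ∉ₛ W ─ B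
  x∈q⇒x∉p─q W B {i} i∈B = trans (lookup-─ W B i) (trans (cong (λ b → lookup W i ∧ not b) i∈B) (∧-zeroʳ _))

  p⊆q⇒∣p∣≤∣q∣ : ∀ {n} {B W : Subset n} → B ⊆ W → ∣ B ∣ ≤ ∣ W ∣
  p⊆q⇒∣p∣≤∣q∣ {B = B} {W} B⊆W =
    ℕ.≤-trans (ℕ.m≤n+m ∣ B ∣ ∣ W ─ B ∣) (ℕ.≤-reflexive (∣p─q∣+∣q∣≡∣p∣ W B B⊆W))

  ∣p─q∣≡∣p∣∸∣q∣ : ∀ {n} (W B : Subset n) → B ⊆ W → ∣ W ─ B ∣ ≡ ∣ W ∣ ∸ ∣ B ∣
  ∣p─q∣≡∣p∣∸∣q∣ W B B⊆W =
    trans (sym (ℕ.m+n∸n≡m ∣ W ─ B ∣ ∣ B ∣)) (cong (_∸ ∣ B ∣) (∣p─q∣+∣q∣≡∣p∣ W B B⊆W))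

  module GraphComplex {n : ℕ} (Adj : Fin n → Fin n → Bool)
    (symmetric : ∀ u v → T (Adj u v) → T (Adj v u))
    (irreflexive : ∀ u → ¬ T (Adj u u)) where

    Γ : Complex n
    Γ = graphComplex Adj

    _~_ : Fin n → Fin n → Set
    u ~ v = Adj u v ≡ true

    ~-sym : ∀ {u v} → u ~ v → v ~ u
    ~-sym {u} {v} = Equivalence.to T-≡ ∘ symmetric u v ∘ Equivalence.from T-≡

    ~⇒≢ : ∀ {u v} → u ~ v → ¬ (u ≡ v)
    ~⇒≢ {u} e refl = irreflexive u (Equivalence.from T-≡ e)

    pair : Fin n → Fin n → Subset n
    pair u v = ⁅ u ⁆ ∪ ⁅ v ⁆

    lookup-pair : ∀ u v i → lookup (pair u v) i ≡ (i ==ᶠ u) ∨ (i ==ᶠ v)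
    lookup-pair u v i = trans (lookup-∪ ⁅ u ⁆ ⁅ v ⁆ i) (cong₂ _∨_ (lookup-⁅⁆ u i) (lookup-⁅⁆ v i))

    ∈-pair⁻ : ∀ u v {i} → i ∈ₛ pair u v → i ≡ u ⊎ i ≡ v
    ∈-pair⁻ u v {i} h with ∨-elim {i ==ᶠ u} (trans (sym (lookup-pair u v i)) h)
    ... | inj₁ k = inj₁ (==ᶠ⇒≡ k)
    ... | inj₂ k = inj₂ (==ᶠ⇒≡ k)

    ∈-pairˡ : ∀ u v → u ∈ₛ pair u v
    ∈-pairˡ u v = trans (lookup-pair u v u) (∨-introˡ (≡⇒==ᶠ {i = u} refl))

    ∈-pairʳ : ∀ u v → v ∈ₛ pair u v
    ∈-pairʳ u v = trans (lookup-pair u v v) (∨-introʳ {v ==ᶠ u} (≡⇒==ᶠ {i = v} refl))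

    ∣pair∣≤2 : ∀ u v → ∣ pair u v ∣ ≤ 2
    ∣pair∣≤2 u v = ℕ.≤-trans (∣p∪q∣≤∣p∣+∣q∣ ⁅ u ⁆ ⁅ v ⁆)
      (ℕ.≤-reflexive (cong₂ _+_ (Subset.∣⁅x⁆∣≡1 u) (Subset.∣⁅x⁆∣≡1 v)))

    face-cases : ∀ X → Γ X ≡ true → ∣ X ∣ ≤ 1 ⊎ ∃ λ u → ∃ λ v → u ~ v × X ≡ pair u v
    face-cases X e with ∨-elim {∣ X ∣ ≤ᵇ 1} e
    ... | inj₁ h = inj₁ (ℕ.≤ᵇ⇒≤ ∣ X ∣ 1 (Equivalence.from T-≡ h))
    ... | inj₂ h with anyFin-witness _ h
    ...   | u , h′ with anyFin-witness _ h′
    ...     | v , h″ = inj₂ (u , v , ∧-elimˡ h″ , ==ˢ⇒≡ (∧-elimʳ {not (u ==ᶠ v)} (∧-elimʳ {Adj u v} h″)))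

    pair-face : ∀ {u v} → u ~ v → Γ (pair u v) ≡ true
    pair-face {u} {v} e = ∨-introʳ {∣ pair u v ∣ ≤ᵇ 1}
      (anyFin-intro _ u (anyFin-intro _ v (∧-intro e (∧-intro (not-intro (≢⇒==ᶠfalse (~⇒≢ e))) (≡⇒==ˢ {X = pair u v} refl)))))

    ∣face∣≤2 : ∀ X → Γ X ≡ true → ∣ X ∣ ≤ 2
    ∣face∣≤2 X e with face-cases X e
    ... | inj₁ h = ℕ.m≤n⇒m≤1+n h
    ... | inj₂ (u , v , _ , refl) = ∣pair∣≤2 u v

    dimLess-restrict : ∀ s → 2 ≤ s → ∀ W → dimLess s (restrict Γ W) ≡ true
    dimLess-restrict s 2≤s W = allL-intro _ (allSubsets n) bounded
      where
      bounded : ∀ Y → (not (restrict Γ W Y) ∨ (∣ Y ∣ ≤ᵇ s)) ≡ true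
      bounded Y with restrict Γ W Y in e
      ... | false = refl
      ... | true with anyL-witness _ (allSubsets n) e
      ...   | X , _ , h with ==ˢ⇒≡ {X = X ∩ W} {Y} (∧-elimʳ {Γ X} h)
      ...     | refl = Equivalence.to T-≡ (ℕ.≤⇒≤ᵇ
                         (ℕ.≤-trans (Subset.∣p∩q∣≤∣p∣ X W) (ℕ.≤-trans (∣face∣≤2 X (∧-elimˡ h)) 2≤s)))

    ~⇒edge : ∀ {W w v} → w ∈ₛ W → v ∈ₛ W → w ~ v → skEdge (restrict Γ W) w v ≡ true
    ~⇒edge {W} {w} {v} w∈W v∈W e =
      ∧-intro (not-intro (≢⇒==ᶠfalse (~⇒≢ e)))
        (anyL-intro _ (∈-allSubsets (pair w v)) (∧-intro (pair-face e) (≡⇒==ˢ {X = pair w v ∩ W} (p⊆q⇒p∩q≡p pair⊆W))))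
      where
      pair⊆W : pair w v ⊆ W
      pair⊆W i i∈pair with ∈-pair⁻ w v i∈pair
      ... | inj₁ refl = w∈W
      ... | inj₂ refl = v∈W

    edge⇒~ : ∀ {W w v} → skEdge (restrict Γ W) w v ≡ true → w ~ v
    edge⇒~ {W} {w} {v} e with anyL-witness _ (allSubsets n) (∧-elimʳ {not (w ==ᶠ v)} e)
    ... | X , _ , h = from-face (face-cases X (∧-elimˡ h))
      where
      w≢v : ¬ (w ≡ v)
      w≢v w≡v = ≡true⇒≢false (≡⇒==ᶠ w≡v) (not-elim (∧-elimˡ e))
      pair⊆X : pair w v ⊆ X
      pair⊆X i i∈pair = ∧-elimˡ (trans (sym (lookup-∩ X W i))
        (trans (cong (λ Z → lookup Z i) (==ˢ⇒≡ {X = X ∩ W} (∧-elimʳ {Γ X} h))) i∈pair))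
      from-face : ∣ X ∣ ≤ 1 ⊎ (∃ λ a → ∃ λ b → a ~ b × X ≡ pair a b) → w ~ v
      from-face (inj₁ ∣X∣≤1) = ⊥-elim (ℕ.<⇒≱ (s≤s ∣X∣≤1) (ℕ.≤-trans
        (2≤count (lookup X) w v w≢v (pair⊆X w (∈-pairˡ w v)) (pair⊆X v (∈-pairʳ w v)))
        (ℕ.≤-reflexive (sym (∣p∣≡count X)))))
      from-face (inj₂ (a , b , a~b , refl))
        with ∈-pair⁻ a b (pair⊆X w (∈-pairˡ w v)) | ∈-pair⁻ a b (pair⊆X v (∈-pairʳ w v))
      ... | inj₁ refl | inj₁ refl = ⊥-elim (w≢v refl)
      ... | inj₁ refl | inj₂ refl = a~b
      ... | inj₂ refl | inj₁ refl = ~-sym a~b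
      ... | inj₂ refl | inj₂ refl = ⊥-elim (w≢v refl)

    opaque
      reachIn : Subset n → ℕ → Fin n → Fin n → Bool
      reachIn W k u v = reach (restrict Γ W) W k u v

    _⊢_⟶[_]_ : Subset n → Fin n → ℕ → Fin n → Set
    W ⊢ u ⟶[ k ] v = reachIn W k u v ≡ true

    module _ (W : Subset n) where

      opaque
        unfolding reachIn

        reach-endpoints : ∀ k {u v} → W ⊢ u ⟶[ k ] v → u ∈ₛ W × v ∈ₛ W
        reach-endpoints zero {u} {v} e with ==ᶠ⇒≡ {i = u} {v} (∧-elimʳ {lookup W u} e)
        ... | refl = ∧-elimˡ e , ∧-elimˡ e
        reach-endpoints (suc k) {u} {v} e with ∨-elim {reachIn W k u v} e
        ... | inj₁ h = reach-endpoints k h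
        ... | inj₂ h with anyFin-witness _ h
        ...   | w , h′ = proj₁ (reach-endpoints k (∧-elimˡ h′)) , ∧-elimˡ (∧-elimʳ {reachIn W k u w} h′)

        reach-refl : ∀ {u} → u ∈ₛ W → W ⊢ u ⟶[ 0 ] u
        reach-refl {u} u∈W = ∧-intro u∈W (≡⇒==ᶠ {i = u} refl)

        reach-zero⇒≡ : ∀ {u v} → W ⊢ u ⟶[ 0 ] v → u ≡ v
        reach-zero⇒≡ {u} {v} e = ==ᶠ⇒≡ (∧-elimʳ {lookup W u} e)

        reach-suc : ∀ k {u v} → W ⊢ u ⟶[ k ] v → W ⊢ u ⟶[ suc k ] v
        reach-suc k = ∨-introˡ

        reach-snoc : ∀ k {u w v} → W ⊢ u ⟶[ k ] w → v ∈ₛ W → w ~ v → W ⊢ u ⟶[ suc k ] v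
        reach-snoc k {u} {w} {v} h v∈W e = ∨-introʳ {reachIn W k u v}
          (anyFin-intro _ w (∧-intro h (∧-intro v∈W (~⇒edge (proj₂ (reach-endpoints k h)) v∈W e))))

        reach-suc⁻ : ∀ k {u v} → W ⊢ u ⟶[ suc k ] v →
                     W ⊢ u ⟶[ k ] v ⊎ ∃ λ w → W ⊢ u ⟶[ k ] w × v ∈ₛ W × w ~ v
        reach-suc⁻ k {u} {v} e with ∨-elim {reachIn W k u v} e
        ... | inj₁ h = inj₁ h
        ... | inj₂ h with anyFin-witness _ h
        ...   | w , h′ = inj₂ (w , ∧-elimˡ h′ , ∧-elimˡ (∧-elimʳ {reachIn W k u w} h′) ,
                               edge⇒~ (∧-elimʳ {lookup W v} (∧-elimʳ {reachIn W k u w} h′)))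

      reach-+ : ∀ d k {u v} → W ⊢ u ⟶[ k ] v → W ⊢ u ⟶[ d + k ] v
      reach-+ zero k h = h
      reach-+ (suc d) k h = reach-suc (d + k) (reach-+ d k h)

      reach-++ : ∀ a b {u w v} → W ⊢ u ⟶[ a ] w → W ⊢ w ⟶[ b ] v → W ⊢ u ⟶[ b + a ] v
      reach-++ a zero h₁ h₂ with reach-zero⇒≡ h₂
      ... | refl = h₁
      reach-++ a (suc b) h₁ h₂ with reach-suc⁻ b h₂
      ... | inj₁ h = reach-suc (b + a) (reach-++ a b h₁ h)
      ... | inj₂ (z , h , v∈W , e) = reach-snoc (b + a) (reach-++ a b h₁ h) v∈W e

      reach-cons : ∀ k {u w v} → u ∈ₛ W → u ~ w → W ⊢ w ⟶[ k ] v → W ⊢ u ⟶[ suc k ] v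
      reach-cons k {u} {w} {v} u∈W e h = subst (λ m → W ⊢ u ⟶[ m ] v) (ℕ.+-comm k 1)
        (reach-++ 1 k (reach-snoc 0 (reach-refl u∈W) (proj₁ (reach-endpoints k h)) e) h)

      reach-sym : ∀ k {u v} → W ⊢ u ⟶[ k ] v → W ⊢ v ⟶[ k ] u
      reach-sym zero h with reach-zero⇒≡ h
      ... | refl = h
      reach-sym (suc k) h with reach-suc⁻ k h
      ... | inj₁ h′ = reach-suc k (reach-sym k h′)
      ... | inj₂ (w , h′ , v∈W , e) = reach-cons k v∈W (~-sym e) (reach-sym k h′)

      -- The sets of vertices reachable from u in k steps increase with k, strictly until they
      -- stabilise; having at most n elements, they are stable from some k ≤ n on.
      module Saturation (u : Fin n) where

        reachable : ℕ → Fin n → Bool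
        reachable k = reachIn W k u

        grows : ℕ → Bool
        grows k = anyFin (λ v → reachable (suc k) v ∧ not (reachable k v))

        stable : ∀ k → grows k ≡ false → ∀ d {v} → W ⊢ u ⟶[ d + k ] v → W ⊢ u ⟶[ k ] v
        stable k stops zero h = h
        stable k stops (suc d) {v} h with reach-suc⁻ (d + k) h
        ... | inj₁ h′ = stable k stops d h′
        ... | inj₂ (w , h′ , v∈W , e) = ¬-not λ v∉ → ≡true⇒≢false
              (anyFin-intro _ v (∧-intro (reach-snoc k (stable k stops d h′) v∈W e) (not-intro v∉))) stops

        growth : ∀ k → u ∈ₛ W → (∀ j → j < k → grows j ≡ true) → suc k ≤ count (reachable k)
        growth zero u∈W _ = 1≤count _ u (reach-refl u∈W)
        growth (suc k) u∈W always with anyFin-witness _ (always k (ℕ.n<1+n k))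
        ... | v , new = ℕ.≤-trans (s≤s (growth k u∈W (λ j j<k → always j (ℕ.m≤n⇒m≤1+n j<k))))
                          (count-mono-< (λ i → reach-suc k) v (not-elim (∧-elimʳ {reachable (suc k) v} new)) (∧-elimˡ new))

        stops : u ∈ₛ W → ∃ λ j → j ≤ n × grows j ≡ false
        stops u∈W with Fin.¬∀⟶∃¬ (suc n) (λ j → grows (toℕ j) ≡ true) (λ j → grows (toℕ j) Bool.≟ true) never
          where
          never : ¬ (∀ (j : Fin (suc n)) → grows (toℕ j) ≡ true)
          never always = ℕ.<⇒≱ (growth (suc n) u∈W always′) (ℕ.m≤n⇒m≤1+n (count≤n _))
            where
            always′ : ∀ j → j < suc n → grows j ≡ true
            always′ j j<1+n = subst (λ i → grows i ≡ true) (Fin.toℕ-fromℕ< j<1+n) (always (fromℕ< j<1+n))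
        ... | j , ¬grows = toℕ j , ℕ.≤-pred (Fin.toℕ<n j) , ¬-not ¬grows

      reach-saturate : ∀ k {u v} → W ⊢ u ⟶[ k ] v → W ⊢ u ⟶[ n ] v
      reach-saturate k {u} {v} h with Saturation.stops u (proj₁ (reach-endpoints k h))
      ... | j , j≤n , stops = subst (λ m → W ⊢ u ⟶[ m ] v) (ℕ.m∸n+n≡m j≤n)
        (reach-+ (n ∸ j) j (Saturation.stable u j stops k (subst (λ m → W ⊢ u ⟶[ m ] v) (ℕ.+-comm j k) (reach-+ j k h))))

      reach-trans : ∀ {u w v} → W ⊢ u ⟶[ n ] w → W ⊢ w ⟶[ n ] v → W ⊢ u ⟶[ n ] v
      reach-trans h₁ h₂ = reach-saturate (n + n) (reach-++ n n h₁ h₂)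

    reach-mono : ∀ {X Y} → X ⊆ Y → ∀ k {u v} → X ⊢ u ⟶[ k ] v → Y ⊢ u ⟶[ k ] v
    reach-mono {X} {Y} X⊆Y zero h with reach-zero⇒≡ X h
    ... | refl = reach-refl Y (X⊆Y _ (proj₁ (reach-endpoints X zero h)))
    reach-mono {X} {Y} X⊆Y (suc k) h with reach-suc⁻ X k h
    ... | inj₁ h′ = reach-suc Y k (reach-mono X⊆Y k h′)
    ... | inj₂ (w , h′ , v∈X , e) = reach-snoc Y k (reach-mono X⊆Y k h′) (X⊆Y _ v∈X) e

  module Rank {n : ℕ} (Adj : Fin n → Fin n → Bool)
    (symmetric : ∀ u v → T (Adj u v) → T (Adj v u))
    (irreflexive : ∀ u → ¬ T (Adj u u)) where

    open GraphComplex Adj symmetric irreflexive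

    rank : Subset n → ℕ
    rank X = rk1 (restrict Γ X) X

    -- Defs counts the components of the 1-skeleton of X by their least vertices, the roots.
    opaque
      isRoot : Subset n → Fin n → Bool
      isRoot X v = lookup X v ∧ not (anyFin (λ w → (toℕ w <ᵇ toℕ v) ∧ reachIn X n w v))

      root-intro : ∀ {X v} → v ∈ₛ X → (∀ w → toℕ w < toℕ v → ¬ X ⊢ w ⟶[ n ] v) → isRoot X v ≡ true
      root-intro {X} {v} v∈X minimal = ∧-intro v∈X (not-intro (anyFin-false _ λ w e →
        minimal w (ℕ.<ᵇ⇒< _ _ (Equivalence.from T-≡ (∧-elimˡ e))) (∧-elimʳ {toℕ w <ᵇ toℕ v} e)))

      root-∈ : ∀ {X v} → isRoot X v ≡ true → v ∈ₛ X
      root-∈ = ∧-elimˡ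

      root-minimal : ∀ {X v} w → isRoot X v ≡ true → toℕ w < toℕ v → ¬ X ⊢ w ⟶[ n ] v
      root-minimal {X} {v} w root w<v w⟶v = ≡true⇒≢false
        (anyFin-intro _ w (∧-intro (Equivalence.to T-≡ (ℕ.<⇒<ᵇ w<v)) w⟶v)) (not-elim (∧-elimʳ {lookup X v} root))

    opaque
      unfolding isRoot reachIn

      rank≡ : ∀ X → rank X ≡ ∣ X ∣ ∸ count (isRoot X)
      rank≡ X = cong (∣ X ∣ ∸_) (countFin≡count (isRoot X))

    roots≤∣∣ : ∀ X → count (isRoot X) ≤ ∣ X ∣
    roots≤∣∣ X = ℕ.≤-trans (count-mono (λ i → root-∈ {X} {i})) (ℕ.≤-reflexive (sym (∣p∣≡count X)))

    DegreeAtMostOne : Subset n → Fin n → Set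
    DegreeAtMostOne X v = ∀ {a b} → a ∈ₛ X → b ∈ₛ X → v ~ a → v ~ b → a ≡ b

    module LeafRemoval (X : Subset n) (v : Fin n) (v∈X : v ∈ₛ X) (leaf : DegreeAtMostOne X v) where

      X′ : Subset n
      X′ = X ─ ⁅ v ⁆

      X′⊆X : X′ ⊆ X
      X′⊆X = p─q⊆p X ⁅ v ⁆

      ∈X′⇒≢ : ∀ {i} → i ∈ₛ X′ → ¬ (i ≡ v)
      ∈X′⇒≢ i∈X′ refl = ≡true⇒≢false i∈X′ (x∉p─⁅x⁆ X v)

      ∈X⇒∈X′ : ∀ {i} → ¬ (i ≡ v) → i ∈ₛ X → i ∈ₛ X′
      ∈X⇒∈X′ i≢v = trans (lookup-─⁅⁆-≢ X i≢v)

      -- A walk in X between vertices other than v can only visit the leaf v as u → v → u.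
      reach-avoiding : ∀ k {x y} → ¬ (x ≡ v) → X ⊢ x ⟶[ k ] y →
                       (¬ (y ≡ v) → X′ ⊢ x ⟶[ n ] y) ×
                       (y ≡ v → ∃ λ u → u ∈ₛ X × v ~ u × X′ ⊢ x ⟶[ n ] u)
      reach-avoiding zero x≢v h with reach-zero⇒≡ X h
      ... | refl = (λ _ → reach-saturate X′ 0 (reach-refl X′ (∈X⇒∈X′ x≢v (proj₁ (reach-endpoints X 0 h)))))
                 , (λ x≡v → ⊥-elim (x≢v x≡v))
      reach-avoiding (suc k) {x} {y} x≢v h with reach-suc⁻ X k h
      ... | inj₁ h′ = reach-avoiding k x≢v h′
      ... | inj₂ (w , h′ , y∈X , w~y) = to-other , to-v
        where
        to-other : ¬ (y ≡ v) → X′ ⊢ x ⟶[ n ] y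
        to-other y≢v with w ≟ v
        ... | no w≢v = reach-saturate X′ (suc n)
                         (reach-snoc X′ n (proj₁ (reach-avoiding k x≢v h′) w≢v) (∈X⇒∈X′ y≢v y∈X) w~y)
        ... | yes refl with proj₂ (reach-avoiding k x≢v h′) refl
        ...   | u , u∈X , v~u , x⟶u with leaf u∈X y∈X v~u w~y
        ...     | refl = x⟶u
        to-v : y ≡ v → ∃ λ u → u ∈ₛ X × v ~ u × X′ ⊢ x ⟶[ n ] u
        to-v refl = w , proj₂ (reach-endpoints X k h′) , ~-sym w~y , proj₁ (reach-avoiding k x≢v h′) (~⇒≢ w~y)

      root-X⇒root-X′ : ∀ {i} → ¬ (i ≡ v) → isRoot X i ≡ true → isRoot X′ i ≡ true
      root-X⇒root-X′ i≢v root = root-intro (∈X⇒∈X′ i≢v (root-∈ root))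
        (λ w w<i w⟶i → root-minimal w root w<i (reach-mono X′⊆X n w⟶i))

      root-X′⇒root-X : ∀ {i} → ¬ (i ≡ v) → isRoot X′ i ≡ true →
                       (toℕ v < toℕ i → ¬ X ⊢ v ⟶[ n ] i) → isRoot X i ≡ true
      root-X′⇒root-X {i} i≢v root v-misses-i = root-intro (X′⊆X i (root-∈ root)) minimal
        where
        minimal : ∀ w → toℕ w < toℕ i → ¬ X ⊢ w ⟶[ n ] i
        minimal w w<i w⟶i with w ≟ v
        ... | yes refl = v-misses-i w<i w⟶i
        ... | no w≢v = root-minimal w root w<i (proj₁ (reach-avoiding n w≢v w⟶i) i≢v)

      v∉roots′ : isRoot X′ v ≡ false
      v∉roots′ = ¬-not λ root → ∈X′⇒≢ (root-∈ root) refl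

      rank-isolated : (∀ {a} → a ∈ₛ X → ¬ v ~ a) → rank X ≡ rank X′
      rank-isolated isolated = begin
        rank X                                          ≡⟨ rank≡ X ⟩
        ∣ X ∣ ∸ count (isRoot X)                        ≡⟨ cong₂ _∸_ (∣p∣≡1+∣p─⁅x⁆∣ X v∈X) roots ⟩
        suc ∣ X′ ∣ ∸ suc (count (isRoot X′))            ≡⟨ sym (rank≡ X′) ⟩
        rank X′                                         ∎
        where
        open ≡-Reasoning
        unreachable : ∀ {w} → ¬ (w ≡ v) → ¬ X ⊢ w ⟶[ n ] v
        unreachable w≢v w⟶v with proj₂ (reach-avoiding n w≢v w⟶v) refl
        ... | u , u∈X , v~u , _ = isolated u∈X v~u
        off-v : ∀ i → isRoot X i ∧ not (i ==ᶠ v) ≡ isRoot X′ i ∧ not (i ==ᶠ v)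
        off-v i with i ≟ v
        ... | yes refl = trans (∧-zeroʳ _) (sym (∧-zeroʳ _))
        ... | no i≢v = cong (_∧ true) (bool-ext (root-X⇒root-X′ i≢v)
                (λ root → root-X′⇒root-X i≢v root (λ _ v⟶i → unreachable i≢v (reach-sym X n v⟶i))))
        v-root : isRoot X v ≡ true
        v-root = root-intro v∈X (λ w w<v → unreachable (λ { refl → ℕ.<-irrefl refl w<v }))
        roots : count (isRoot X) ≡ suc (count (isRoot X′))
        roots = begin
          count (isRoot X)                            ≡⟨ sym (ℕ.+-identityʳ _) ⟩
          count (isRoot X) + fromBool false           ≡⟨ cong (λ b → count (isRoot X) + fromBool b) (sym v∉roots′) ⟩
          count (isRoot X) + fromBool (isRoot X′ v)   ≡⟨ count-exchange (isRoot X) (isRoot X′) v v off-v ⟩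
          count (isRoot X′) + fromBool (isRoot X v)   ≡⟨ cong (λ b → count (isRoot X′) + fromBool b) v-root ⟩
          count (isRoot X′) + 1                       ≡⟨ ℕ.+-comm _ 1 ⟩
          suc (count (isRoot X′))                     ∎

      module Pendant {u : Fin n} (u∈X : u ∈ₛ X) (v~u : v ~ u) where

        u∈X′ : u ∈ₛ X′
        u∈X′ = ∈X⇒∈X′ (λ u≡v → ~⇒≢ v~u (sym u≡v)) u∈X

        through-u : ∀ {w} → ¬ (w ≡ v) → X ⊢ w ⟶[ n ] v → X′ ⊢ w ⟶[ n ] u
        through-u w≢v w⟶v with proj₂ (reach-avoiding n w≢v w⟶v) refl
        ... | u′ , u′∈X , v~u′ , w⟶u′ with leaf u′∈X u∈X v~u′ v~u
        ... | refl = w⟶u′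

        via-u : ∀ {w} → X′ ⊢ w ⟶[ n ] u → X ⊢ w ⟶[ n ] v
        via-u w⟶u = reach-saturate X (suc n) (reach-snoc X n (reach-mono X′⊆X n w⟶u) v∈X (~-sym v~u))

        -- m is the root, in X′, of the component of u
        opaque
          least : ∃ λ m → X′ ⊢ u ⟶[ n ] m × (∀ j → X′ ⊢ u ⟶[ n ] j → toℕ m ≤ toℕ j)
          least = least-true (reachIn X′ n u) u (reach-saturate X′ 0 (reach-refl X′ u∈X′))

        m : Fin n
        m = proj₁ least

        u⟶m : X′ ⊢ u ⟶[ n ] m
        u⟶m = proj₁ (proj₂ least)

        m-minimal : ∀ j → X′ ⊢ u ⟶[ n ] j → toℕ m ≤ toℕ j
        m-minimal = proj₂ (proj₂ least)

        m≢v : ¬ (m ≡ v)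
        m≢v = ∈X′⇒≢ (proj₂ (reach-endpoints X′ n u⟶m))

        unique-root : ∀ {x} → isRoot X′ x ≡ true → X′ ⊢ u ⟶[ n ] x → x ≡ m
        unique-root {x} root u⟶x with ℕ.m≤n⇒m<n∨m≡n (m-minimal x u⟶x)
        ... | inj₁ m<x = ⊥-elim (root-minimal m root m<x (reach-trans X′ (reach-sym X′ n u⟶m) u⟶x))
        ... | inj₂ m≡x = sym (Fin.toℕ-injective m≡x)

        roots-agree : ∀ {i} → ¬ (i ≡ v) → (i ≡ m → toℕ v < toℕ i → ⊥) → isRoot X i ≡ isRoot X′ i
        roots-agree i≢v not-m-above-v = bool-ext (root-X⇒root-X′ i≢v) λ root →
          root-X′⇒root-X i≢v root λ v<i v⟶i →
            not-m-above-v (unique-root root (reach-sym X′ n (through-u i≢v (reach-sym X n v⟶i)))) v<i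

        exchange : ∀ x y {b} → (∀ i → isRoot X i ∧ not (i ==ᶠ x) ≡ isRoot X′ i ∧ not (i ==ᶠ y)) →
                   isRoot X x ≡ b → isRoot X′ y ≡ b → count (isRoot X) ≡ count (isRoot X′)
        exchange x y off refl p′y = ℕ.+-cancelʳ-≡ _ _ _
          (trans (cong (λ b → count (isRoot X) + fromBool b) (sym p′y)) (count-exchange (isRoot X) (isRoot X′) x y off))

        -- X and X′ have the same roots, except that when v < m the root m of the component of u
        -- in X′ gives way to v in X.
        roots : count (isRoot X) ≡ count (isRoot X′)
        roots with ℕ.<-cmp (toℕ m) (toℕ v)
        ... | tri≈ _ m≡v _ = ⊥-elim (m≢v (Fin.toℕ-injective m≡v))
        ... | tri< m<v _ _ = exchange v v off v-not-root v∉roots′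
          where
          v-not-root : isRoot X v ≡ false
          v-not-root = ¬-not λ root → root-minimal m root m<v (via-u (reach-sym X′ n u⟶m))
          off : ∀ i → isRoot X i ∧ not (i ==ᶠ v) ≡ isRoot X′ i ∧ not (i ==ᶠ v)
          off i with i ≟ v
          ... | yes refl = trans (∧-zeroʳ _) (sym (∧-zeroʳ _))
          ... | no i≢v = cong (_∧ true) (roots-agree i≢v λ { refl v<m → ℕ.<-asym m<v v<m })
        ... | tri> _ _ v<m = exchange v m off v-root m-root′
          where
          v-root : isRoot X v ≡ true
          v-root = root-intro v∈X λ w w<v w⟶v →
            ℕ.<⇒≱ (ℕ.<-trans w<v v<m) (m-minimal w (reach-sym X′ n (through-u (λ { refl → ℕ.<-irrefl refl w<v }) w⟶v)))
          m-root′ : isRoot X′ m ≡ true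
          m-root′ = root-intro (proj₂ (reach-endpoints X′ n u⟶m)) λ w w<m w⟶m →
            ℕ.<⇒≱ w<m (m-minimal w (reach-trans X′ u⟶m (reach-sym X′ n w⟶m)))
          m-not-root : isRoot X m ≡ false
          m-not-root = ¬-not λ root → root-minimal v root v<m
            (reach-saturate X (suc n) (reach-cons X n v∈X v~u (reach-mono X′⊆X n u⟶m)))
          off : ∀ i → isRoot X i ∧ not (i ==ᶠ v) ≡ isRoot X′ i ∧ not (i ==ᶠ m)
          off i with i ≟ v | i ≟ m
          ... | yes refl | yes i≡m = ⊥-elim (m≢v (sym i≡m))
          ... | yes refl | no _ = trans (∧-zeroʳ _) (sym (trans (∧-identityʳ _) v∉roots′))
          ... | no _ | yes refl = trans (trans (∧-identityʳ _) m-not-root) (sym (∧-zeroʳ _))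
          ... | no i≢v | no i≢m = cong (_∧ true) (roots-agree i≢v λ i≡m _ → i≢m i≡m)

        rank-pendant : rank X ≡ suc (rank X′)
        rank-pendant = begin
          rank X                                    ≡⟨ rank≡ X ⟩
          ∣ X ∣ ∸ count (isRoot X)                  ≡⟨ cong₂ _∸_ (∣p∣≡1+∣p─⁅x⁆∣ X v∈X) roots ⟩
          suc ∣ X′ ∣ ∸ count (isRoot X′)            ≡⟨ ℕ.+-∸-assoc 1 (roots≤∣∣ X′) ⟩
          suc (∣ X′ ∣ ∸ count (isRoot X′))          ≡⟨ cong suc (sym (rank≡ X′)) ⟩
          suc (rank X′)                             ∎
          where open ≡-Reasoning

  Unique-++⁻ˡ : ∀ {A : Set} (xs : List A) {ys} → Unique (xs ++ ys) → Unique xs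
  Unique-++⁻ˡ [] _ = []
  Unique-++⁻ˡ (x ∷ xs) (x∉ ∷ u) = ++⁻ˡ xs x∉ ∷ Unique-++⁻ˡ xs u

  Unique⇒length≤ : ∀ {n} (xs : List (Fin n)) → Unique xs → length xs ≤ n
  Unique⇒length≤ {n} xs u = ℕ.≤-trans (go xs u) (count≤n _)
    where
    occurs : List (Fin n) → Fin n → Bool
    occurs xs i = anyL (i ==ᶠ_) xs
    go : ∀ xs → Unique xs → length xs ≤ count (occurs xs)
    go [] _ = z≤n
    go (x ∷ xs) (x∉xs ∷ u) = ℕ.≤-trans (s≤s (go xs u))
      (count-mono-< (λ i → ∨-introʳ {i ==ᶠ x}) x (¬-not (x∉ x∉xs)) (∨-introˡ (≡⇒==ᶠ {i = x} refl)))
      where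
      x∉ : ∀ {ys} → All (λ y → ¬ x ≡ y) ys → ¬ anyL (x ==ᶠ_) ys ≡ true
      x∉ (x≢y ∷ _) e with ∨-elim e
      ... | inj₁ h = x≢y (==ᶠ⇒≡ h)
      x∉ (_ ∷ ps) e | inj₂ h = x∉ ps h

  module Tree {n : ℕ} (Adj : Fin n → Fin n → Bool) (tree : IsTree Adj) where
    open IsTree tree
    open GraphComplex Adj symmetric irreflexive
    open Rank Adj symmetric irreflexive

    Chain-cut : ∀ (xs : List (Fin n)) z ys c → Chain Adj (xs ++ z ∷ ys) → T (Adj z c) → Chain Adj (xs ++ z ∷ c ∷ [])
    Chain-cut [] z ys c _ z~c = z~c , tt
    Chain-cut (a ∷ []) z ys c (a~z , _) z~c = a~z , z~c , tt
    Chain-cut (a ∷ b ∷ xs) z ys c (a~b , ch) z~c = a~b , Chain-cut (b ∷ xs) z ys c ch z~c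

    module _ (W : Subset n) where

      degree≤1? : Fin n → Bool
      degree≤1? v = allFin? (λ a → allFin? (λ b → not (lookup W a ∧ lookup W b ∧ Adj v a ∧ Adj v b) ∨ (a ==ᶠ b)))

      isLeaf : Fin n → Bool
      isLeaf v = lookup W v ∧ degree≤1? v

      isLeaf⇒degree≤1 : ∀ {v} → isLeaf v ≡ true → DegreeAtMostOne W v
      isLeaf⇒degree≤1 {v} leaf {a} {b} a∈W b∈W v~a v~b
        with ∨-elim {not (lookup W a ∧ lookup W b ∧ Adj v a ∧ Adj v b)}
               (allFin?-elim _ (allFin?-elim _ (∧-elimʳ {lookup W v} leaf) a) b)
      ... | inj₁ k = ⊥-elim (≡true⇒≢false (∧-intro a∈W (∧-intro b∈W (∧-intro v~a v~b))) (not-elim k))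
      ... | inj₂ k = ==ᶠ⇒≡ k

      another-neighbour : ∀ {v} → isLeaf v ≡ false → v ∈ₛ W → ∀ y →
                          ∃ λ z → z ∈ₛ W × v ~ z × ¬ (z ≡ y)
      another-neighbour {v} ¬leaf v∈W y with allFin?-false _ (subst (λ b → b ∧ degree≤1? v ≡ false) v∈W ¬leaf)
      ... | a , h with allFin?-false _ h
      ...   | b , h′ with not-∨-false h′
      ...     | both , a≢b with a ≟ y
      ...       | yes refl = b , ∧-elimˡ (∧-elimʳ {lookup W a} both) ,
                             ∧-elimʳ {Adj v a} (∧-elimʳ {lookup W b} (∧-elimʳ {lookup W a} both)) ,
                             λ b≡a → ≡true⇒≢false (≡⇒==ᶠ {i = a} (sym b≡a)) a≢b
      ...       | no a≢y = a , ∧-elimˡ both , ∧-elimˡ (∧-elimʳ {lookup W b} (∧-elimʳ {lookup W a} both)) , a≢y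

      -- Without leaves, the path c p … can always be extended at c: either the new neighbour closes
      -- a cycle, or after n extensions the path has more than n distinct vertices.
      leafless⇒¬simple-path : (∀ v → isLeaf v ≡ false) → ∀ fuel c p rest → length rest + fuel ≡ n →
                  c ∈ₛ W → Unique (c ∷ p ∷ rest) → Chain Adj (c ∷ p ∷ rest) → ⊥
      leafless⇒¬simple-path no-leaf fuel c p rest len c∈W u ch with another-neighbour (no-leaf c) c∈W p
      ... | z , z∈W , c~z , z≢p with DecMembership._∈?_ _≟_ z (c ∷ p ∷ rest)
      ... | yes (here refl) = irreflexive z (Equivalence.from T-≡ c~z)
      ... | yes (there (here refl)) = z≢p refl
      ... | yes (there (there z∈rest)) with ∈-∃++ z∈rest
      ...   | ys , zs , refl = acyclic (c ∷ p ∷ ys ++ [ z ]) (2≤ , unique , closed)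
        where
        2≤ : 2 ≤ length (p ∷ ys ++ [ z ])
        2≤ = s≤s (ℕ.≤-trans (s≤s z≤n) (ℕ.≤-reflexive (sym (trans (List.length-++ ys) (ℕ.+-comm (length ys) 1)))))
        unique : Unique (c ∷ p ∷ ys ++ [ z ])
        unique = Unique-++⁻ˡ (c ∷ p ∷ ys ++ [ z ]) (subst Unique (cong (λ l → c ∷ p ∷ l) (sym (List.++-assoc ys [ z ] zs))) u)
        closed : Chain Adj ((c ∷ p ∷ ys ++ [ z ]) ++ [ c ])
        closed = subst (Chain Adj) (cong (λ l → c ∷ p ∷ l) (sym (List.++-assoc ys [ z ] [ c ])))
                   (Chain-cut (c ∷ p ∷ ys) z zs c ch (symmetric c z (Equivalence.from T-≡ c~z)))
      leafless⇒¬simple-path no-leaf zero c p rest len c∈W u ch | z , _ , _ , _ | no z∉ =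
        ℕ.<-irrefl refl (ℕ.≤-trans too-long (Unique⇒length≤ (z ∷ c ∷ p ∷ rest) (¬Any⇒All¬ _ z∉ ∷ u)))
        where
        too-long : suc n ≤ length (z ∷ c ∷ p ∷ rest)
        too-long = ℕ.≤-trans (ℕ.≤-reflexive (cong suc (sym (trans (sym (ℕ.+-identityʳ _)) len)))) (ℕ.m≤n+m (suc (length rest)) 2)
      leafless⇒¬simple-path no-leaf (suc fuel) c p rest len c∈W u ch | z , z∈W , c~z , _ | no z∉ =
        leafless⇒¬simple-path no-leaf fuel z c (p ∷ rest) (trans (sym (ℕ.+-suc (length rest) fuel)) len) z∈W
          (¬Any⇒All¬ _ z∉ ∷ u) (symmetric c z (Equivalence.from T-≡ c~z) , ch)

      leafless⇒empty : (∀ v → isLeaf v ≡ false) → ∀ {x} → ¬ x ∈ₛ W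
      leafless⇒empty no-leaf {x} x∈W with another-neighbour (no-leaf x) x∈W x
      ... | z , z∈W , x~z , z≢x = leafless⇒¬simple-path no-leaf n z x [] refl z∈W ((z≢x ∷ []) ∷ [] ∷ [])
                                    (symmetric x z (Equivalence.from T-≡ x~z) , tt)

      leaf-exists : ∀ {x} → x ∈ₛ W → ∃ λ v → v ∈ₛ W × DegreeAtMostOne W v
      leaf-exists {x} x∈W with anyFin isLeaf in some-leaf
      ... | true with anyFin-witness isLeaf some-leaf
      ...   | v , leaf = v , ∧-elimˡ leaf , isLeaf⇒degree≤1 leaf
      leaf-exists {x} x∈W | false = ⊥-elim (leafless⇒empty no-leaf x∈W)
        where
        no-leaf : ∀ v → isLeaf v ≡ false
        no-leaf v = ¬-not λ leaf → ≡true⇒≢false (anyFin-intro isLeaf v leaf) some-leaf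

    walk⇒reach : ∀ k {a u x} → full ⊢ a ⟶[ k ] u → Walk Adj u x → full ⊢ a ⟶[ n ] x
    walk⇒reach k h here = reach-saturate full k h
    walk⇒reach k h (step {v = v} e w) =
      walk⇒reach (suc k) (reach-snoc full k h (lookup-full v) (Equivalence.to T-≡ e)) w

    rank-full : Fin n → rank full ≡ n ∸ 1
    rank-full z with least-true (λ _ → true) z refl
    ... | m , _ , m-minimal = begin
      rank full                                                   ≡⟨ rank≡ full ⟩
      ∣ full {n} ∣ ∸ count (isRoot full)                          ≡⟨ cong₂ _∸_ (Subset.∣⊤∣≡n n) (count-remove (isRoot full) m) ⟩
      n ∸ (count (λ i → isRoot full i ∧ not (i ==ᶠ m)) + fromBool (isRoot full m))
                                                                  ≡⟨ cong₂ (λ c b → n ∸ (c + fromBool b)) (count-false _ only-m) m-root ⟩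
      n ∸ 1                                                       ∎
      where
      open ≡-Reasoning
      m-root : isRoot full m ≡ true
      m-root = root-intro (lookup-full m) λ w w<m _ → ℕ.<⇒≱ w<m (m-minimal w refl)
      only-m : ∀ i → isRoot full i ∧ not (i ==ᶠ m) ≡ false
      only-m i with i ≟ m
      ... | yes _ = ∧-zeroʳ _
      ... | no i≢m with ℕ.m≤n⇒m<n∨m≡n (m-minimal i refl)
      ...   | inj₂ m≡i = ⊥-elim (i≢m (sym (Fin.toℕ-injective m≡i)))
      ...   | inj₁ m<i = trans (∧-identityʳ _) (¬-not λ root →
                root-minimal m root m<i (walk⇒reach 0 (reach-refl full (lookup-full m)) (connected m i)))

open Combinatorics

open import Data.Nat using () renaming (_+_ to _+ℕ_)
open import Data.Nat.Properties using (_!≢0)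
import Data.Nat.DivMod as ℕDiv
open import Data.Integer using (+_; _/ℕ_) renaming (_*_ to _*ℤ_)
import Data.Integer as Int
import Data.Integer.Properties as ℤ

module Sums {c ℓ : Level} (R : CommutativeRing c ℓ) where
  open CommutativeRing R hiding (zero)
  open import Algebra.Properties.Ring ring using (-‿+-comm; -0#≈0#)
  open import Algebra.Solver.CommutativeMonoid +-commutativeMonoid using (solve; _⊜_; _⊕_)

  ∑ : List Carrier → Carrier
  ∑ = sumR R

  ∑-++ : ∀ xs ys → ∑ (xs ++ ys) ≈ ∑ xs + ∑ ys
  ∑-++ [] ys = sym (+-identityˡ _)
  ∑-++ (x ∷ xs) ys = trans (+-congˡ (∑-++ xs ys)) (sym (+-assoc x _ _))

  module _ {A : Set} where

    ∑-cong : ∀ {f g : A → Carrier} xs → (∀ x → f x ≈ g x) → ∑ (map f xs) ≈ ∑ (map g xs)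
    ∑-cong [] h = refl
    ∑-cong (x ∷ xs) h = +-cong (h x) (∑-cong xs h)

    ∑-0 : ∀ xs → ∑ (map (λ (_ : A) → 0#) xs) ≈ 0#
    ∑-0 [] = refl
    ∑-0 (x ∷ xs) = trans (+-congˡ (∑-0 xs)) (+-identityˡ 0#)

    ∑-+ : ∀ (f g : A → Carrier) xs → ∑ (map (λ x → f x + g x) xs) ≈ ∑ (map f xs) + ∑ (map g xs)
    ∑-+ f g [] = sym (+-identityˡ 0#)
    ∑-+ f g (x ∷ xs) = trans (+-congˡ (∑-+ f g xs))
      (solve 4 (λ a b c d → (a ⊕ b) ⊕ (c ⊕ d) ⊜ (a ⊕ c) ⊕ (b ⊕ d)) refl (f x) (g x) (∑ (map f xs)) (∑ (map g xs)))

    ∑-*ˡ : ∀ k (f : A → Carrier) xs → ∑ (map (λ x → k * f x) xs) ≈ k * ∑ (map f xs)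
    ∑-*ˡ k f [] = sym (zeroʳ k)
    ∑-*ˡ k f (x ∷ xs) = trans (+-congˡ (∑-*ˡ k f xs)) (sym (distribˡ k (f x) _))

    ∑-*ʳ : ∀ k (f : A → Carrier) xs → ∑ (map (λ x → f x * k) xs) ≈ ∑ (map f xs) * k
    ∑-*ʳ k f xs = trans (∑-cong xs (λ x → *-comm (f x) k)) (trans (∑-*ˡ k f xs) (*-comm k _))

    ∑-neg : ∀ (f : A → Carrier) xs → ∑ (map (λ x → - f x) xs) ≈ - ∑ (map f xs)
    ∑-neg f [] = sym -0#≈0#
    ∑-neg f (x ∷ xs) = trans (+-congˡ (∑-neg f xs)) (-‿+-comm (f x) _)

    ∑-filter : ∀ (p : A → Bool) (g : A → Carrier) xs →
               ∑ (map g (filterB p xs)) ≈ ∑ (map (λ x → if p x then g x else 0#) xs)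
    ∑-filter p g [] = refl
    ∑-filter p g (x ∷ xs) with p x
    ... | true = +-congˡ (∑-filter p g xs)
    ... | false = trans (∑-filter p g xs) (sym (+-identityˡ _))

  ∑-map-∘ : ∀ {A B : Set} (f : B → Carrier) (g : A → B) xs → ∑ (map f (map g xs)) ≈ ∑ (map (λ x → f (g x)) xs)
  ∑-map-∘ f g xs = reflexive (≡.cong ∑ (≡.sym (List.map-∘ xs)))

  ∑-concatMap : ∀ {A B : Set} (f : B → Carrier) (g : A → List B) xs →
                ∑ (map f (concatMap g xs)) ≈ ∑ (map (λ x → ∑ (map f (g x))) xs)
  ∑-concatMap f g [] = refl
  ∑-concatMap f g (x ∷ xs) = trans (reflexive (≡.cong ∑ (List.map-++ f (g x) (concatMap g xs))))
    (trans (∑-++ (map f (g x)) _) (+-congˡ (∑-concatMap f g xs)))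

  ∑-comm : ∀ {A B : Set} (f : A → B → Carrier) xs ys →
           ∑ (map (λ x → ∑ (map (f x) ys)) xs) ≈ ∑ (map (λ y → ∑ (map (λ x → f x y) xs)) ys)
  ∑-comm f [] ys = sym (∑-0 ys)
  ∑-comm f (x ∷ xs) ys = trans (+-congˡ (∑-comm f xs ys)) (sym (∑-+ (f x) _ ys))

-1-k≡-[1+k] : ∀ k → -[1+ 0 ] Int.- + k ≡ -[1+ k ]
-1-k≡-[1+k] zero = ≡.refl
-1-k≡-[1+k] (suc k) = ≡.refl

k!*[-1-k] : ∀ k → + (k !) *ℤ (-[1+ 0 ] Int.- + k) ≡ Int.- (+ (suc k !))
k!*[-1-k] k = begin
  + (k !) *ℤ (-[1+ 0 ] Int.- + k)   ≡⟨ ≡.cong (+ (k !) *ℤ_) (-1-k≡-[1+k] k) ⟩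
  + (k !) *ℤ -[1+ k ]               ≡⟨ ℤ.*-comm (+ (k !)) -[1+ k ] ⟩
  Int.- (+ suc k) *ℤ + (k !)        ≡⟨ ℤ.neg-distribˡ-* (+ suc k) (+ (k !)) ⟨
  Int.- (+ suc k *ℤ + (k !))        ≡⟨ ≡.cong Int.-_ (ℤ.pos-* (suc k) (k !)) ⟨
  Int.- (+ (suc k !))               ∎
  where open ≡.≡-Reasoning

-k!*[-1-k] : ∀ k → Int.- (+ (k !)) *ℤ (-[1+ 0 ] Int.- + k) ≡ + (suc k !)
-k!*[-1-k] k = begin
  Int.- (+ (k !)) *ℤ (-[1+ 0 ] Int.- + k)   ≡⟨ ℤ.neg-distribˡ-* (+ (k !)) _ ⟨
  Int.- (+ (k !) *ℤ (-[1+ 0 ] Int.- + k))   ≡⟨ ≡.cong Int.-_ (k!*[-1-k] k) ⟩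
  Int.- (Int.- (+ (suc k !)))               ≡⟨ ℤ.neg-involutive _ ⟩
  + (suc k !)                               ∎
  where open ≡.≡-Reasoning

+n/ℕn≡1 : ∀ n .{{_ : NonZero n}} → (+ n) /ℕ n ≡ + 1
+n/ℕn≡1 n = ≡.cong +_ (ℕDiv.n/n≡1 n)

-n/ℕn≡-1 : ∀ n .{{_ : NonZero n}} → (Int.- (+ n)) /ℕ n ≡ -[1+ 0 ]
-n/ℕn≡-1 (suc n) rewrite ℕDiv.n%n≡0 (suc n) {{_}} | ℕDiv.n/n≡1 (suc n) {{_}} = ≡.refl

module Signs {c ℓ : Level} (R : CommutativeRing c ℓ) where
  open CommutativeRing R hiding (zero)
  open import Algebra.Properties.Ring ring using (-1*x≈-x; -‿involutive)
  open import Algebra.Solver.CommutativeMonoid *-commutativeMonoid using (solve; _⊜_; _⊕_)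
  open import Relation.Binary.Reasoning.Setoid setoid

  -1ᴿ : Carrier
  -1ᴿ = - 1#

  pow-+ : ∀ x i j → pow R x (i +ℕ j) ≈ pow R x i * pow R x j
  pow-+ x zero j = sym (*-identityˡ _)
  pow-+ x (suc i) j = trans (*-congˡ (pow-+ x i j)) (sym (*-assoc x _ _))

  -1²≈1 : -1ᴿ * -1ᴿ ≈ 1#
  -1²≈1 = trans (-1*x≈-x -1ᴿ) (-‿involutive 1#)

  sign-square : ∀ k → pow R -1ᴿ k * pow R -1ᴿ k ≈ 1#
  sign-square zero = *-identityˡ 1#
  sign-square (suc k) = trans (solve 2 (λ a s → (a ⊕ s) ⊕ (a ⊕ s) ⊜ (a ⊕ a) ⊕ (s ⊕ s)) refl -1ᴿ (pow R -1ᴿ k))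
    (trans (*-cong -1²≈1 (sign-square k)) (*-identityˡ 1#))

  sign-∸ : ∀ m a → a ≤ m → pow R -1ᴿ (m ∸ a) ≈ pow R -1ᴿ m * pow R -1ᴿ a
  sign-∸ m a a≤m = begin
    pow R -1ᴿ (m ∸ a)                                          ≈⟨ sym (*-identityʳ _) ⟩
    pow R -1ᴿ (m ∸ a) * 1#                                     ≈⟨ *-congˡ (sym (sign-square a)) ⟩
    pow R -1ᴿ (m ∸ a) * (pow R -1ᴿ a * pow R -1ᴿ a)            ≈⟨ sym (*-assoc _ _ _) ⟩
    (pow R -1ᴿ (m ∸ a) * pow R -1ᴿ a) * pow R -1ᴿ a            ≈⟨ *-congʳ (sym (pow-+ -1ᴿ (m ∸ a) a)) ⟩
    pow R -1ᴿ (m ∸ a +ℕ a) * pow R -1ᴿ a                       ≈⟨ reflexive (≡.cong (λ k → pow R -1ᴿ k * _) (ℕ.m∸n+n≡m a≤m)) ⟩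
    pow R -1ᴿ m * pow R -1ᴿ a                                  ∎

  falling-minus-one : ∀ k → (falling -[1+ 0 ] k ≡ + (k !) × pow R -1ᴿ k ≈ 1#)
                          ⊎ (falling -[1+ 0 ] k ≡ Int.- (+ (k !)) × pow R -1ᴿ k ≈ -1ᴿ)
  falling-minus-one zero = inj₁ (≡.refl , refl)
  falling-minus-one (suc k) with falling-minus-one k
  ... | inj₁ (e , p) = inj₂ (≡.trans (≡.cong (_*ℤ (-[1+ 0 ] Int.- + k)) e) (k!*[-1-k] k) , trans (*-congˡ p) (*-identityʳ -1ᴿ))
  ... | inj₂ (e , p) = inj₁ (≡.trans (≡.cong (_*ℤ (-[1+ 0 ] Int.- + k)) e) (-k!*[-1-k] k) , trans (*-congˡ p) -1²≈1)

  binom-minus-one : ∀ k → intR R (binomℤ -[1+ 0 ] k) ≈ pow R -1ᴿ k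
  binom-minus-one k with falling-minus-one k
  ... | inj₁ (e , p) rewrite e = trans (reflexive (≡.cong (intR R) (+n/ℕn≡1 (k !) {{k !≢0}}))) (trans (+-identityʳ 1#) (sym p))
  ... | inj₂ (e , p) rewrite e = trans (reflexive (≡.cong (intR R) (-n/ℕn≡-1 (k !) {{k !≢0}}))) (trans (-‿cong (+-identityʳ 1#)) (sym p))

module Compositions {c ℓ : Level} (R : CommutativeRing c ℓ) where
  open CommutativeRing R hiding (zero)
  open Sums R
  open import Algebra.Properties.Ring ring using (-‿+-comm; -0#≈0#)
  open import Relation.Binary.Reasoning.Setoid setoid

  ∑< : ℕ → (ℕ → Carrier) → Carrier
  ∑< zero g = 0#
  ∑< (suc k) g = g 0 + ∑< k (λ a → g (suc a))

  ∑<-cong : ∀ k {f g : ℕ → Carrier} → (∀ a → f a ≈ g a) → ∑< k f ≈ ∑< k g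
  ∑<-cong zero h = refl
  ∑<-cong (suc k) h = +-cong (h 0) (∑<-cong k (λ a → h (suc a)))

  ∑<-*ˡ : ∀ k x (f : ℕ → Carrier) → ∑< k (λ a → x * f a) ≈ x * ∑< k f
  ∑<-*ˡ zero x f = sym (zeroʳ x)
  ∑<-*ˡ (suc k) x f = trans (+-congˡ (∑<-*ˡ k x _)) (sym (distribˡ x _ _))

  ∑<-neg : ∀ k (f : ℕ → Carrier) → ∑< k (λ a → - f a) ≈ - ∑< k f
  ∑<-neg zero f = sym -0#≈0#
  ∑<-neg (suc k) f = trans (+-congˡ (∑<-neg k _)) (-‿+-comm _ _)

  ∑<-∑ : ∀ {A : Set} k (g : ℕ → A → Carrier) xs →
         ∑< k (λ a → ∑ (map (g a) xs)) ≈ ∑ (map (λ x → ∑< k (λ a → g a x)) xs)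
  ∑<-∑ zero g xs = sym (∑-0 xs)
  ∑<-∑ (suc k) g xs = trans (+-congˡ (∑<-∑ k _ xs)) (sym (∑-+ _ _ xs))

  ∑<-0 : ∀ k → ∑< k (λ _ → 0#) ≈ 0#
  ∑<-0 zero = refl
  ∑<-0 (suc k) = trans (+-congˡ (∑<-0 k)) (+-identityʳ 0#)

  ∑<-indicator : ∀ k i (x : Carrier) → i ≤ k → ∑< k (λ a → if i ==ℕ suc a then x else 0#) ≈ (if i ==ℕ 0 then 0# else x)
  ∑<-indicator k zero x _ = ∑<-0 k
  ∑<-indicator (suc k) (suc zero) x _ = trans (+-congˡ (∑<-0 k)) (+-identityʳ x)
  ∑<-indicator (suc k) (suc (suc i)) x (s≤s i≤k) = trans (+-identityˡ _) (∑<-indicator k (suc i) x i≤k)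

  atIncHead : (List ℕ → Carrier) → List ℕ → Carrier
  atIncHead f [] = 0#
  atIncHead f (a ∷ β) = f (suc a ∷ β)

  -- Defs builds the compositions of m + 1 from those of m by prepending 1 or incrementing the head.
  ∑-compositions-suc : ∀ m (f : List ℕ → Carrier) →
    ∑ (map f (compositions (suc m))) ≈ ∑ (map (λ β → f (1 ∷ β)) (compositions m)) + ∑ (map (atIncHead f) (compositions m))
  ∑-compositions-suc m f = begin
    ∑ (map f (concatMap extendComp (compositions m)))
      ≈⟨ ∑-concatMap f extendComp (compositions m) ⟩
    ∑ (map (λ α → ∑ (map f (extendComp α))) (compositions m))
      ≈⟨ ∑-cong (compositions m) split ⟩
    ∑ (map (λ α → f (1 ∷ α) + atIncHead f α) (compositions m))
      ≈⟨ ∑-+ _ _ (compositions m) ⟩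
    ∑ (map (λ β → f (1 ∷ β)) (compositions m)) + ∑ (map (atIncHead f) (compositions m)) ∎
    where
    split : ∀ α → ∑ (map f (extendComp α)) ≈ f (1 ∷ α) + atIncHead f α
    split [] = refl
    split (a ∷ β) = +-congˡ (+-identityʳ _)

  ∑-compositions-by-head : ∀ m (f : List ℕ → Carrier) →
    ∑ (map f (compositions (suc m))) ≈ ∑< (suc m) (λ a → ∑ (map (λ β → f (suc a ∷ β)) (compositions (m ∸ a))))
  ∑-compositions-by-head zero f = trans (∑-compositions-suc zero f) (+-congˡ (+-identityʳ 0#))
  ∑-compositions-by-head (suc m) f =
    trans (∑-compositions-suc (suc m) f) (+-congˡ (∑-compositions-by-head m (atIncHead f)))

module SubsetSums {c ℓ : Level} (R : CommutativeRing c ℓ) where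
  open CommutativeRing R hiding (zero)
  open Sums R
  open import Relation.Binary.Reasoning.Setoid setoid

  ∑ˢ : ∀ {n} → (Subset n → Carrier) → Carrier
  ∑ˢ {n} g = ∑ (map g (allSubsets n))

  ∑ˢ-cong : ∀ {n} {f g : Subset n → Carrier} → (∀ B → f B ≈ g B) → ∑ˢ f ≈ ∑ˢ g
  ∑ˢ-cong {n} = ∑-cong (allSubsets n)

  ∑ˢ-split : ∀ {n} (g : Subset (suc n) → Carrier) → ∑ˢ g ≈ ∑ˢ (λ B → g (false ∷ B)) + ∑ˢ (λ B → g (true ∷ B))
  ∑ˢ-split {n} g = begin
    ∑ (map g (map (false ∷_) (allSubsets n) ++ map (true ∷_) (allSubsets n)))
      ≈⟨ reflexive (≡.cong ∑ (List.map-++ g (map (false ∷_) (allSubsets n)) _)) ⟩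
    ∑ (map g (map (false ∷_) (allSubsets n)) ++ map g (map (true ∷_) (allSubsets n)))
      ≈⟨ ∑-++ (map g (map (false ∷_) (allSubsets n))) _ ⟩
    ∑ (map g (map (false ∷_) (allSubsets n))) + ∑ (map g (map (true ∷_) (allSubsets n)))
      ≈⟨ +-cong (∑-map-∘ g (false ∷_) (allSubsets n)) (∑-map-∘ g (true ∷_) (allSubsets n)) ⟩
    ∑ˢ (λ B → g (false ∷ B)) + ∑ˢ (λ B → g (true ∷ B)) ∎

  ∑ˢ-pair-off : ∀ {n} (v : Fin n) (g : Subset n → Carrier) →
                ∑ˢ g ≈ ∑ˢ (λ B → if lookup B v then 0# else g B + g (B ∪ ⁅ v ⁆))
  ∑ˢ-pair-off {suc n} zero g = begin
    ∑ˢ g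
      ≈⟨ ∑ˢ-split g ⟩
    ∑ˢ (λ B → g (false ∷ B)) + ∑ˢ (λ B → g (true ∷ B))
      ≈⟨ sym (∑-+ (λ B → g (false ∷ B)) (λ B → g (true ∷ B)) (allSubsets n)) ⟩
    ∑ˢ (λ B → g (false ∷ B) + g (true ∷ B))
      ≈⟨ ∑ˢ-cong (λ B → +-congˡ (reflexive (≡.cong (λ C → g (true ∷ C)) (≡.sym (Subset.∪-identityʳ B))))) ⟩
    ∑ˢ (λ B → g (false ∷ B) + g (true ∷ (B ∪ empty)))
      ≈⟨ sym (+-identityʳ _) ⟩
    ∑ˢ (λ B → g (false ∷ B) + g (true ∷ (B ∪ empty))) + 0#
      ≈⟨ +-congˡ (sym (∑-0 (allSubsets n))) ⟩
    ∑ˢ (λ B → g (false ∷ B) + g (true ∷ (B ∪ empty))) + ∑ˢ {n} (λ _ → 0#)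
      ≈⟨ sym (∑ˢ-split (λ B → if lookup B zero then 0# else g B + g (B ∪ ⁅ zero ⁆))) ⟩
    ∑ˢ (λ B → if lookup B zero then 0# else g B + g (B ∪ ⁅ zero ⁆)) ∎
  ∑ˢ-pair-off {suc n} (suc v) g = begin
    ∑ˢ g
      ≈⟨ ∑ˢ-split g ⟩
    ∑ˢ (λ B → g (false ∷ B)) + ∑ˢ (λ B → g (true ∷ B))
      ≈⟨ +-cong (∑ˢ-pair-off v (λ B → g (false ∷ B))) (∑ˢ-pair-off v (λ B → g (true ∷ B))) ⟩
    _ ≈⟨ sym (∑ˢ-split (λ B → if lookup B (suc v) then 0# else g B + g (B ∪ ⁅ suc v ⁆))) ⟩
    ∑ˢ (λ B → if lookup B (suc v) then 0# else g B + g (B ∪ ⁅ suc v ⁆)) ∎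

  ∑ˢ-empty : ∀ {n} (g : Subset n → Carrier) → ∑ˢ (λ B → if ∣ B ∣ ==ℕ 0 then g B else 0#) ≈ g empty
  ∑ˢ-empty {zero} g = +-identityʳ _
  ∑ˢ-empty {suc n} g = begin
    ∑ˢ (λ B → if ∣ B ∣ ==ℕ 0 then g B else 0#)
      ≈⟨ ∑ˢ-split (λ B → if ∣ B ∣ ==ℕ 0 then g B else 0#) ⟩
    ∑ˢ (λ B → if ∣ B ∣ ==ℕ 0 then g (false ∷ B) else 0#) + ∑ˢ {n} (λ _ → 0#)
      ≈⟨ +-cong (∑ˢ-empty (λ B → g (false ∷ B))) (∑-0 (allSubsets n)) ⟩
    g empty + 0#
      ≈⟨ +-identityʳ _ ⟩
    g empty ∎

module PairIdentities {c ℓ : Level} (R : CommutativeRing c ℓ) (q : CommutativeRing.Carrier R) where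
  open CommutativeRing R hiding (zero)
  open Signs R using (-1ᴿ)
  open import Algebra.Properties.Ring ring using (-1*x≈-x; -‿involutive)
  open import Algebra.Solver.CommutativeMonoid *-commutativeMonoid using (solve; _⊜_; _⊕_)
  open import Relation.Binary.Reasoning.Setoid setoid

  -1*a*w≈-[a*w] : ∀ a w → (-1ᴿ * a) * w ≈ - (a * w)
  -1*a*w≈-[a*w] a w = trans (*-assoc -1ᴿ a w) (-1*x≈-x (a * w))

  pair-pendant-in : ∀ a x y → a * (x * y) + (-1ᴿ * a) * ((- q * x) * y) ≈ (q + 1#) * (a * (x * y))
  pair-pendant-in a x y = begin
    a * (x * y) + (-1ᴿ * a) * ((- q * x) * y)
      ≈⟨ +-congˡ (solve 5 (λ m a p x y → (m ⊕ a) ⊕ ((p ⊕ x) ⊕ y) ⊜ (m ⊕ p) ⊕ (a ⊕ (x ⊕ y))) refl -1ᴿ a (- q) x y) ⟩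
    a * (x * y) + (-1ᴿ * - q) * (a * (x * y))    ≈⟨ +-congˡ (*-congʳ (trans (-1*x≈-x (- q)) (-‿involutive q))) ⟩
    a * (x * y) + q * (a * (x * y))              ≈⟨ +-congʳ (sym (*-identityˡ _)) ⟩
    1# * (a * (x * y)) + q * (a * (x * y))       ≈⟨ sym (distribʳ _ 1# q) ⟩
    (1# + q) * (a * (x * y))                     ≈⟨ *-congʳ (+-comm 1# q) ⟩
    (q + 1#) * (a * (x * y))                     ∎

  pair-pendant-out : ∀ a x y → a * (x * ((q + natR R 2) * y)) + (-1ᴿ * a) * (x * y) ≈ (q + 1#) * (a * (x * y))
  pair-pendant-out a x y = begin
    a * (x * ((q + natR R 2) * y)) + (-1ᴿ * a) * (x * y)
      ≈⟨ +-cong (solve 4 (λ c a x y → a ⊕ (x ⊕ (c ⊕ y)) ⊜ c ⊕ (a ⊕ (x ⊕ y))) refl (q + natR R 2) a x y) (-1*a*w≈-[a*w] a _) ⟩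
    (q + (1# + (1# + 0#))) * z + - z
      ≈⟨ +-congʳ (*-congʳ (trans (+-congˡ (+-congˡ (+-identityʳ 1#))) (sym (+-assoc q 1# 1#)))) ⟩
    ((q + 1#) + 1#) * z + - z                    ≈⟨ +-congʳ (distribʳ z (q + 1#) 1#) ⟩
    ((q + 1#) * z + 1# * z) + - z                ≈⟨ +-assoc _ _ _ ⟩
    (q + 1#) * z + (1# * z + - z)                ≈⟨ +-congˡ (trans (+-congʳ (*-identityˡ z)) (-‿inverseʳ z)) ⟩
    (q + 1#) * z + 0#                            ≈⟨ +-identityʳ _ ⟩
    (q + 1#) * z                                 ∎
    where
    z : Carrier
    z = a * (x * y)

  pair-isolated : ∀ a w → a * w + (-1ᴿ * a) * w ≈ 0# * (a * w)
  pair-isolated a w = trans (+-congˡ (-1*a*w≈-[a*w] a w)) (trans (-‿inverseʳ _) (sym (zeroˡ _)))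

module AlternatingSum {c ℓ : Level} (R : CommutativeRing c ℓ) (q : CommutativeRing.Carrier R)
  {n : ℕ} (Adj : Fin n → Fin n → Bool) (tree : IsTree Adj) where

  open CommutativeRing R hiding (zero)
  open IsTree tree
  open GraphComplex Adj symmetric irreflexive
  open Rank Adj symmetric irreflexive
  open Tree Adj tree using (leaf-exists)
  open Sums R
  open SubsetSums R
  open Signs R using (-1ᴿ)
  open PairIdentities R q
  open import Relation.Binary.Reasoning.Setoid setoid

  q+2 : Carrier
  q+2 = q + natR R 2

  term : Subset n → Subset n → Carrier
  term W B = pow R -1ᴿ ∣ B ∣ * (pow R (- q) (rank B) * pow R q+2 (rank (W ─ B)))

  alternating : Subset n → Carrier
  alternating W = ∑ˢ (λ B → if B ⊆ᵇ W then term W B else 0#)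

  module Step (W : Subset n) (v : Fin n) (v∈W : v ∈ₛ W) (leaf : DegreeAtMostOne W v) where

    W′ : Subset n
    W′ = W ─ ⁅ v ⁆

    leaf-in : ∀ X → X ⊆ W → DegreeAtMostOne X v
    leaf-in X X⊆W a∈X b∈X = leaf (X⊆W _ a∈X) (X⊆W _ b∈X)

    isolated-in : ∀ X {u} → X ⊆ W → u ∈ₛ W → v ~ u → u ∉ₛ X → ∀ {a} → a ∈ₛ X → ¬ v ~ a
    isolated-in X X⊆W u∈W v~u u∉X a∈X v~a with leaf (X⊆W _ a∈X) u∈W v~a v~u
    ... | ≡.refl = ≡true⇒≢false a∈X u∉X

    module Pair (B : Subset n) (v∉B : v ∉ₛ B) (B⊆W : B ⊆ W) where

      X₁ X₂ : Subset n
      X₁ = B ∪ ⁅ v ⁆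
      X₂ = W ─ B

      X₁⊆W : X₁ ⊆ W
      X₁⊆W i i∈X₁ with x∈p∪⁅y⁆⁻ B i∈X₁
      ... | inj₁ i∈B = B⊆W i i∈B
      ... | inj₂ ≡.refl = v∈W

      module L₁ = LeafRemoval X₁ v (x∈p∪⁅x⁆ B v) (leaf-in X₁ X₁⊆W)
      module L₂ = LeafRemoval X₂ v (x∈p⇒x∉q⇒x∈p─q W B v∈W v∉B) (leaf-in X₂ (p─q⊆p W B))

      a x y : Carrier
      a = pow R -1ᴿ ∣ B ∣
      x = pow R (- q) (rank B)
      y = pow R q+2 (rank (W′ ─ B))

      term-B : ∀ {r} → rank X₂ ≡ r → term W B ≡ a * (x * pow R q+2 r)
      term-B ≡.refl = ≡.refl

      term-X₁ : ∀ {r} → rank X₁ ≡ r → term W X₁ ≡ (-1ᴿ * a) * (pow R (- q) r * y)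
      term-X₁ rank≡r = ≡.cong₂ (λ k w → pow R -1ᴿ k * w) ∣X₁∣≡1+∣B∣
        (≡.cong₂ (λ r Z → pow R (- q) r * pow R q+2 (rank Z)) rank≡r (p─[q∪⁅x⁆]≡p─⁅x⁆─q W B v))
        where
        ∣X₁∣≡1+∣B∣ : ∣ X₁ ∣ ≡ suc ∣ B ∣
        ∣X₁∣≡1+∣B∣ = ≡.trans (∣p∣≡1+∣p─⁅x⁆∣ X₁ (x∈p∪⁅x⁆ B v)) (≡.cong (λ Z → suc ∣ Z ∣) (p∪⁅x⁆─⁅x⁆≡p B v∉B))

      rank-X₁-pendant : ∀ {u} → u ∈ₛ B → v ~ u → rank X₁ ≡ suc (rank B)
      rank-X₁-pendant u∈B v~u =
        ≡.trans (L₁.Pendant.rank-pendant (x∈p⇒x∈p∪⁅y⁆ B u∈B) v~u) (≡.cong (λ Z → suc (rank Z)) (p∪⁅x⁆─⁅x⁆≡p B v∉B))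

      rank-X₁-isolated : (∀ {a} → a ∈ₛ X₁ → ¬ v ~ a) → rank X₁ ≡ rank B
      rank-X₁-isolated isolated = ≡.trans (L₁.rank-isolated isolated) (≡.cong rank (p∪⁅x⁆─⁅x⁆≡p B v∉B))

      rank-X₂-pendant : ∀ {u} → u ∈ₛ X₂ → v ~ u → rank X₂ ≡ suc (rank (W′ ─ B))
      rank-X₂-pendant u∈X₂ v~u = ≡.trans (L₂.Pendant.rank-pendant u∈X₂ v~u) (≡.cong (λ Z → suc (rank Z)) (p─q─⁅x⁆≡p─⁅x⁆─q W B v))

      rank-X₂-isolated : (∀ {a} → a ∈ₛ X₂ → ¬ v ~ a) → rank X₂ ≡ rank (W′ ─ B)
      rank-X₂-isolated isolated = ≡.trans (L₂.rank-isolated isolated) (≡.cong rank (p─q─⁅x⁆≡p─⁅x⁆─q W B v))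

      pair-with-neighbour : ∀ {u} → u ∈ₛ W → v ~ u → term W B + term W X₁ ≈ (q + 1#) * term W′ B
      pair-with-neighbour {u} u∈W v~u with lookup B u in u∈B?
      ... | true = begin
        term W B + term W X₁
          ≈⟨ +-cong (reflexive (term-B (rank-X₂-isolated (isolated-in X₂ (p─q⊆p W B) u∈W v~u (x∈q⇒x∉p─q W B u∈B?)))))
                    (reflexive (term-X₁ (rank-X₁-pendant u∈B? v~u))) ⟩
        a * (x * y) + (-1ᴿ * a) * ((- q * x) * y)   ≈⟨ pair-pendant-in a x y ⟩
        (q + 1#) * term W′ B                         ∎
      ... | false = begin
        term W B + term W X₁
          ≈⟨ +-cong (reflexive (term-B (rank-X₂-pendant (x∈p⇒x∉q⇒x∈p─q W B u∈W u∈B?) v~u)))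
                    (reflexive (term-X₁ (rank-X₁-isolated (isolated-in X₁ X₁⊆W u∈W v~u u∉X₁)))) ⟩
        a * (x * (q+2 * y)) + (-1ᴿ * a) * (x * y)     ≈⟨ pair-pendant-out a x y ⟩
        (q + 1#) * term W′ B                         ∎
        where
        u∉X₁ : u ∉ₛ X₁
        u∉X₁ = ≡.trans (lookup-∪ B ⁅ v ⁆ u)
                 (≡.cong₂ _∨_ u∈B? (≡.trans (lookup-⁅⁆ v u) (≢⇒==ᶠfalse (λ u≡v → ~⇒≢ v~u (≡.sym u≡v)))))

      pair-isolated-v : (∀ {a} → a ∈ₛ W → ¬ v ~ a) → term W B + term W X₁ ≈ 0# * term W′ B
      pair-isolated-v isolated = begin
        term W B + term W X₁
          ≈⟨ +-cong (reflexive (term-B (rank-X₂-isolated (isolated ∘ p─q⊆p W B _))))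
                    (reflexive (term-X₁ (rank-X₁-isolated (isolated ∘ X₁⊆W _)))) ⟩
        a * (x * y) + (-1ᴿ * a) * (x * y)            ≈⟨ pair-isolated a (x * y) ⟩
        0# * term W′ B                               ∎

    ⊆W⇔⊆W′ : ∀ B → v ∉ₛ B → (B ⊆ᵇ W) ≡ (B ⊆ᵇ W′)
    ⊆W⇔⊆W′ B v∉B = bool-ext
      (λ B⊆W → ⊆⇒⊆ᵇ B W′ λ i i∈B → x∈p⇒x∉q⇒x∈p─q W ⁅ v ⁆ (⊆ᵇ⇒⊆ B W B⊆W i i∈B)
                 (≡.trans (lookup-⁅⁆ v i) (≢⇒==ᶠfalse {i = i} λ { ≡.refl → ≡true⇒≢false i∈B v∉B })))
      (λ B⊆W′ → ⊆⇒⊆ᵇ B W λ i i∈B → p─q⊆p W ⁅ v ⁆ i (⊆ᵇ⇒⊆ B W′ B⊆W′ i i∈B))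

    ∪⊆W⇔⊆W′ : ∀ B → v ∉ₛ B → ((B ∪ ⁅ v ⁆) ⊆ᵇ W) ≡ (B ⊆ᵇ W′)
    ∪⊆W⇔⊆W′ B v∉B = ≡.trans (bool-ext
      (λ B∪v⊆W → ⊆⇒⊆ᵇ B W λ i i∈B → ⊆ᵇ⇒⊆ (B ∪ ⁅ v ⁆) W B∪v⊆W i (x∈p⇒x∈p∪⁅y⁆ B i∈B))
      (λ B⊆W → ⊆⇒⊆ᵇ (B ∪ ⁅ v ⁆) W λ i i∈B∪v → case (x∈p∪⁅y⁆⁻ B i∈B∪v) (⊆ᵇ⇒⊆ B W B⊆W i)))
      (⊆W⇔⊆W′ B v∉B)
      where
      case : ∀ {i} → i ∈ₛ B ⊎ i ≡ v → (i ∈ₛ B → i ∈ₛ W) → i ∈ₛ W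
      case (inj₁ i∈B) B⊆W = B⊆W i∈B
      case (inj₂ ≡.refl) _ = v∈W

    ∋v⇒⊈W′ : ∀ B → v ∈ₛ B → (B ⊆ᵇ W′) ≡ false
    ∋v⇒⊈W′ B v∈B = ¬-not λ B⊆W′ → ≡true⇒≢false (⊆ᵇ⇒⊆ B W′ B⊆W′ v v∈B) (x∉p─⁅x⁆ W v)

    alternating-step : ∀ κ → (∀ B → v ∉ₛ B → B ⊆ W → term W B + term W (B ∪ ⁅ v ⁆) ≈ κ * term W′ B) →
                       alternating W ≈ κ * alternating W′
    alternating-step κ pairs = begin
      alternating W
        ≈⟨ ∑ˢ-pair-off v restricted ⟩
      ∑ˢ (λ B → if lookup B v then 0# else restricted B + restricted (B ∪ ⁅ v ⁆))
        ≈⟨ ∑ˢ-cong pointwise ⟩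
      ∑ˢ (λ B → κ * (if B ⊆ᵇ W′ then term W′ B else 0#))
        ≈⟨ ∑-*ˡ κ _ (allSubsets n) ⟩
      κ * alternating W′ ∎
      where
      restricted : Subset n → Carrier
      restricted B = if B ⊆ᵇ W then term W B else 0#
      pointwise : ∀ B → (if lookup B v then 0# else restricted B + restricted (B ∪ ⁅ v ⁆))
                        ≈ κ * (if B ⊆ᵇ W′ then term W′ B else 0#)
      pointwise B with lookup B v in v∈B?
      ... | true rewrite ∋v⇒⊈W′ B v∈B? = sym (zeroʳ κ)
      ... | false rewrite ⊆W⇔⊆W′ B v∈B? | ∪⊆W⇔⊆W′ B v∈B? with B ⊆ᵇ W′ in B⊆W′
      ...   | true = pairs B v∈B? (⊆ᵇ⇒⊆ B W (≡.trans (⊆W⇔⊆W′ B v∈B?) B⊆W′))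
      ...   | false = trans (+-identityˡ 0#) (sym (zeroʳ κ))

  alternating≈0 : ∀ k W → ∣ W ∣ ≡ suc k → alternating W ≈ 0#
  alternating≈0 k W ∣W∣≡1+k
    with count-witness (lookup W) (ℕ.≤-trans (s≤s z≤n) (ℕ.≤-reflexive (≡.trans (≡.sym ∣W∣≡1+k) (∣p∣≡count W))))
  ... | x , x∈W with leaf-exists W x∈W
  ... | v , v∈W , leaf with anyFin (λ a → lookup W a ∧ Adj v a) in neighbour?
  ... | false = trans (Step.alternating-step W v v∈W leaf 0# λ B v∉B B⊆W → Step.Pair.pair-isolated-v W v v∈W leaf B v∉B B⊆W isolated) (zeroˡ _)
    where
    isolated : ∀ {a} → a ∈ₛ W → ¬ v ~ a
    isolated {a} a∈W v~a = ≡true⇒≢false (anyFin-intro _ a (∧-intro a∈W v~a)) neighbour?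
  ... | true with anyFin-witness _ neighbour?
  ...   | u , u∈W∧v~u = trans (Step.alternating-step W v v∈W leaf (q + 1#) λ B v∉B B⊆W →
                                 Step.Pair.pair-with-neighbour W v v∈W leaf B v∉B B⊆W u∈W v~u)
                               (trans (*-congˡ (alternating-W′≈0 k ∣W′∣≡k)) (zeroʳ _))
    where
    u∈W : u ∈ₛ W
    u∈W = ∧-elimˡ u∈W∧v~u
    v~u : v ~ u
    v~u = ∧-elimʳ {lookup W u} u∈W∧v~u
    W′ : Subset n
    W′ = W ─ ⁅ v ⁆
    ∣W′∣≡k : ∣ W′ ∣ ≡ k
    ∣W′∣≡k = ℕ.suc-injective (≡.trans (≡.sym (∣p∣≡1+∣p─⁅x⁆∣ W v∈W)) ∣W∣≡1+k)
    alternating-W′≈0 : ∀ j → ∣ W′ ∣ ≡ j → alternating W′ ≈ 0#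
    alternating-W′≈0 zero ∣W′∣≡0 = ⊥-elim (ℕ.<-irrefl ≡.refl (ℕ.≤-trans
      (1≤count (lookup W′) u (x∈p⇒x∉q⇒x∈p─q W ⁅ v ⁆ u∈W (≡.trans (lookup-⁅⁆ v u) (≢⇒==ᶠfalse (λ u≡v → ~⇒≢ v~u (≡.sym u≡v))))))
      (ℕ.≤-reflexive (≡.trans (≡.sym (∣p∣≡count W′)) ∣W′∣≡0))))
    alternating-W′≈0 (suc j) ∣W′∣≡1+j = alternating≈0 j W′ ∣W′∣≡1+j

  term-empty : ∀ W → term W empty ≈ pow R q+2 (rank W)
  term-empty W = begin
    pow R -1ᴿ ∣ empty {n} ∣ * (pow R (- q) (rank empty) * pow R q+2 (rank (W ─ empty)))
      ≈⟨ reflexive (≡.cong₂ (λ k w → pow R -1ᴿ k * w) (Subset.∣⊥∣≡0 n)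
                     (≡.cong₂ (λ r Z → pow R (- q) r * pow R q+2 (rank Z)) rank-empty (Subset.p─⊥≡p W))) ⟩
    1# * (1# * pow R q+2 (rank W))   ≈⟨ trans (*-identityˡ _) (*-identityˡ _) ⟩
    pow R q+2 (rank W)               ∎
    where
    rank-empty : rank empty ≡ 0
    rank-empty = ≡.trans (rank≡ empty) (≡.trans (≡.cong (_∸ count (isRoot empty)) (Subset.∣⊥∣≡0 n)) (ℕ.0∸n≡0 (count (isRoot empty))))

  alternating-nonempty : ∀ k W → ∣ W ∣ ≡ suc k →
    ∑ˢ (λ B → if B ⊆ᵇ W then (if ∣ B ∣ ==ℕ 0 then 0# else term W B) else 0#) ≈ - pow R q+2 (rank W)
  alternating-nonempty k W ∣W∣≡1+k = begin
    N                        ≈⟨ sym (+-identityʳ N) ⟩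
    N + 0#                   ≈⟨ +-congˡ (sym (-‿inverseʳ Y)) ⟩
    N + (Y + - Y)            ≈⟨ sym (+-assoc N Y (- Y)) ⟩
    (N + Y) + - Y            ≈⟨ +-congʳ (trans (sym split) (alternating≈0 k W ∣W∣≡1+k)) ⟩
    0# + - Y                 ≈⟨ +-identityˡ _ ⟩
    - Y                      ∎
    where
    N Y : Carrier
    N = ∑ˢ (λ B → if B ⊆ᵇ W then (if ∣ B ∣ ==ℕ 0 then 0# else term W B) else 0#)
    Y = pow R q+2 (rank W)
    split-if : ∀ b z (t : Carrier) → (if b then t else 0#) ≈ (if b then (if z then 0# else t) else 0#) + (if z then (if b then t else 0#) else 0#)
    split-if true true t = sym (+-identityˡ t)
    split-if true false t = sym (+-identityʳ t)
    split-if false true t = sym (+-identityˡ 0#)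
    split-if false false t = sym (+-identityˡ 0#)
    empty⊆W : empty ⊆ W
    empty⊆W i i∈∅ = ⊥-elim (≡true⇒≢false i∈∅ (lookup-empty i))
    split : alternating W ≈ N + Y
    split = begin
      alternating W
        ≈⟨ ∑ˢ-cong (λ B → split-if (B ⊆ᵇ W) (∣ B ∣ ==ℕ 0) (term W B)) ⟩
      ∑ˢ (λ B → (if B ⊆ᵇ W then (if ∣ B ∣ ==ℕ 0 then 0# else term W B) else 0#)
                + (if ∣ B ∣ ==ℕ 0 then (if B ⊆ᵇ W then term W B else 0#) else 0#))
        ≈⟨ ∑-+ _ _ (allSubsets n) ⟩
      N + ∑ˢ (λ B → if ∣ B ∣ ==ℕ 0 then (if B ⊆ᵇ W then term W B else 0#) else 0#)
        ≈⟨ +-congˡ (∑ˢ-empty (λ B → if B ⊆ᵇ W then term W B else 0#)) ⟩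
      N + (if empty ⊆ᵇ W then term W empty else 0#)
        ≈⟨ +-congˡ (trans (reflexive (≡.cong (λ b → if b then term W empty else 0#) (⊆⇒⊆ᵇ empty W empty⊆W))) (term-empty W)) ⟩
      N + Y ∎

module FirstBlockExpansion {c ℓ : Level} (R : CommutativeRing c ℓ) (q : CommutativeRing.Carrier R)
  (s : ℕ) (2≤s : 2 ≤ s) {n : ℕ} (Adj : Fin n → Fin n → Bool) (tree : IsTree Adj) where

  open CommutativeRing R hiding (zero)
  open IsTree tree
  open GraphComplex Adj symmetric irreflexive
  open Rank Adj symmetric irreflexive
  open Sums R
  open SubsetSums R
  open Compositions R
  open Signs R
  open AlternatingSum R q Adj tree
  open import Algebra.Properties.Ring ring using (-1*x≈-x; -‿involutive; -‿distribʳ-*)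
  open import Algebra.Solver.CommutativeMonoid *-commutativeMonoid using (solve; _⊜_; _⊕_)
  open import Relation.Binary.Reasoning.Setoid setoid

  ζ : Subset n → Carrier
  ζ B = zetaMinusq R q s (restrict Γ B) B

  ζ≈ : ∀ B → ζ B ≈ pow R (- q) (rank B)
  ζ≈ B = reflexive (≡.cong (λ b → if b then pow R (- q) (rank B) else 0#) (dimLess-restrict s 2≤s B))

  F : List ℕ → Subset n → Carrier
  F α W = ∑ (map (λ P → prodR R (map ζ P)) (orderedSetPartitions α W))

  K : ℕ → Subset n → Carrier
  K m W = ∑ (map (λ α → F α W * pow R -1ᴿ (length α)) (compositions m))

  F-nil : ∀ W → ∣ W ∣ ≡ 0 → F [] W ≈ 1#
  F-nil W ∣W∣≡0 rewrite ∣W∣≡0 = +-identityʳ 1#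

  F-cons : ∀ a β W → F (a ∷ β) W ≈ ∑ (map (λ B → ζ B * F β (W ─ B)) (subsetsOfSize a W))
  F-cons a β W = trans (∑-concatMap _ (λ B → map (B ∷_) (orderedSetPartitions β (W ─ B))) (subsetsOfSize a W))
    (∑-cong (subsetsOfSize a W) λ B → trans (∑-map-∘ _ (B ∷_) (orderedSetPartitions β (W ─ B)))
       (∑-*ˡ (ζ B) _ (orderedSetPartitions β (W ─ B))))

  K-first-block : ∀ m W →
    K (suc m) W ≈ - ∑< (suc m) (λ a → ∑ (map (λ B → ζ B * K (m ∸ a) (W ─ B)) (subsetsOfSize (suc a) W)))
  K-first-block m W = begin
    K (suc m) W
      ≈⟨ ∑-compositions-by-head m (λ α → F α W * pow R -1ᴿ (length α)) ⟩
    ∑< (suc m) (λ a → ∑ (map (λ β → F (suc a ∷ β) W * pow R -1ᴿ (suc (length β))) (compositions (m ∸ a))))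
      ≈⟨ ∑<-cong (suc m) by-head ⟩
    ∑< (suc m) (λ a → - ∑ (map (λ B → ζ B * K (m ∸ a) (W ─ B)) (subsetsOfSize (suc a) W)))
      ≈⟨ ∑<-neg (suc m) (λ a → ∑ (map (λ B → ζ B * K (m ∸ a) (W ─ B)) (subsetsOfSize (suc a) W))) ⟩
    - ∑< (suc m) (λ a → ∑ (map (λ B → ζ B * K (m ∸ a) (W ─ B)) (subsetsOfSize (suc a) W))) ∎
    where
    by-head : ∀ a → ∑ (map (λ β → F (suc a ∷ β) W * pow R -1ᴿ (suc (length β))) (compositions (m ∸ a)))
                    ≈ - ∑ (map (λ B → ζ B * K (m ∸ a) (W ─ B)) (subsetsOfSize (suc a) W))
    by-head a = begin
      ∑ (map (λ β → F (suc a ∷ β) W * (-1ᴿ * sign β)) comps)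
        ≈⟨ ∑-cong comps one-composition ⟩
      ∑ (map (λ β → - ∑ (map (λ B → ζ B * (F β (W ─ B) * sign β)) blocks)) comps)
        ≈⟨ ∑-neg _ comps ⟩
      - ∑ (map (λ β → ∑ (map (λ B → ζ B * (F β (W ─ B) * sign β)) blocks)) comps)
        ≈⟨ -‿cong (∑-comm (λ β B → ζ B * (F β (W ─ B) * sign β)) comps blocks) ⟩
      - ∑ (map (λ B → ∑ (map (λ β → ζ B * (F β (W ─ B) * sign β)) comps)) blocks)
        ≈⟨ -‿cong (∑-cong blocks λ B → ∑-*ˡ (ζ B) (λ β → F β (W ─ B) * sign β) comps) ⟩
      - ∑ (map (λ B → ζ B * K (m ∸ a) (W ─ B)) blocks) ∎
      where
      comps : List (List ℕ)
      comps = compositions (m ∸ a)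
      blocks : List (Subset n)
      blocks = subsetsOfSize (suc a) W
      sign : List ℕ → Carrier
      sign β = pow R -1ᴿ (length β)
      one-composition : ∀ β → F (suc a ∷ β) W * (-1ᴿ * sign β) ≈ - ∑ (map (λ B → ζ B * (F β (W ─ B) * sign β)) blocks)
      one-composition β = begin
        F (suc a ∷ β) W * (-1ᴿ * sign β)
          ≈⟨ solve 3 (λ f m p → f ⊕ (m ⊕ p) ⊜ m ⊕ (f ⊕ p)) refl (F (suc a ∷ β) W) -1ᴿ (sign β) ⟩
        -1ᴿ * (F (suc a ∷ β) W * sign β)
          ≈⟨ -1*x≈-x _ ⟩
        - (F (suc a ∷ β) W * sign β)
          ≈⟨ -‿cong (*-congʳ (F-cons (suc a) β W)) ⟩
        - (∑ (map (λ B → ζ B * F β (W ─ B)) blocks) * sign β)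
          ≈⟨ -‿cong (sym (∑-*ʳ (sign β) _ blocks)) ⟩
        - ∑ (map (λ B → (ζ B * F β (W ─ B)) * sign β) blocks)
          ≈⟨ -‿cong (∑-cong blocks λ B → *-assoc (ζ B) _ _) ⟩
        - ∑ (map (λ B → ζ B * (F β (W ─ B) * sign β)) blocks) ∎

  ∑-by-size : ∀ m W (t : Subset n → Carrier) → ∣ W ∣ ≡ suc m →
    ∑< (suc m) (λ a → ∑ˢ (λ B → if (∣ B ∣ ==ℕ suc a) ∧ (B ⊆ᵇ W) then t B else 0#))
    ≈ ∑ˢ (λ B → if B ⊆ᵇ W then (if ∣ B ∣ ==ℕ 0 then 0# else t B) else 0#)
  ∑-by-size m W t ∣W∣≡1+m = trans (∑<-∑ (suc m) (λ a B → if (∣ B ∣ ==ℕ suc a) ∧ (B ⊆ᵇ W) then t B else 0#) (allSubsets n))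
    (∑ˢ-cong one-subset)
    where
    one-subset : ∀ B → ∑< (suc m) (λ a → if (∣ B ∣ ==ℕ suc a) ∧ (B ⊆ᵇ W) then t B else 0#)
                       ≈ (if B ⊆ᵇ W then (if ∣ B ∣ ==ℕ 0 then 0# else t B) else 0#)
    one-subset B with B ⊆ᵇ W in B⊆W
    ... | true = trans (∑<-cong (suc m) λ a → reflexive (≡.cong (λ b → if b then t B else 0#) (∧-identityʳ (∣ B ∣ ==ℕ suc a))))
                   (∑<-indicator (suc m) ∣ B ∣ (t B) (ℕ.≤-trans (p⊆q⇒∣p∣≤∣q∣ {B = B} {W} (⊆ᵇ⇒⊆ B W B⊆W)) (ℕ.≤-reflexive ∣W∣≡1+m)))
    ... | false = trans (∑<-cong (suc m) λ a → reflexive (≡.cong (λ b → if b then t B else 0#) (∧-zeroʳ (∣ B ∣ ==ℕ suc a))))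
                    (∑<-0 (suc m))

  block-contribution : ∀ m a W B → ∣ B ∣ ≡ suc a → a ≤ m →
    K (m ∸ a) (W ─ B) ≈ pow R -1ᴿ (m ∸ a) * pow R q+2 (rank (W ─ B)) →
    ζ B * K (m ∸ a) (W ─ B) ≈ pow R -1ᴿ (suc m) * term W B
  block-contribution m a W B ∣B∣≡1+a a≤m K≈ = begin
    ζ B * K (m ∸ a) (W ─ B)
      ≈⟨ *-cong (ζ≈ B) K≈ ⟩
    x * (pow R -1ᴿ (m ∸ a) * y)
      ≈⟨ *-congˡ (*-congʳ (sign-∸ (suc m) (suc a) (s≤s a≤m))) ⟩
    x * ((pow R -1ᴿ (suc m) * pow R -1ᴿ (suc a)) * y)
      ≈⟨ solve 4 (λ x p s y → x ⊕ ((p ⊕ s) ⊕ y) ⊜ p ⊕ (s ⊕ (x ⊕ y))) refl x (pow R -1ᴿ (suc m)) (pow R -1ᴿ (suc a)) y ⟩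
    pow R -1ᴿ (suc m) * (pow R -1ᴿ (suc a) * (x * y))
      ≈⟨ *-congˡ (*-congʳ (reflexive (≡.cong (pow R -1ᴿ) (≡.sym ∣B∣≡1+a)))) ⟩
    pow R -1ᴿ (suc m) * term W B ∎
    where
    x y : Carrier
    x = pow R (- q) (rank B)
    y = pow R q+2 (rank (W ─ B))

  K≈ : ∀ k m W → m ≤ k → ∣ W ∣ ≡ m → K m W ≈ pow R -1ᴿ m * pow R q+2 (rank W)
  K≈ k zero W _ ∣W∣≡0 = begin
    F [] W * 1# + 0#          ≈⟨ +-identityʳ _ ⟩
    F [] W * 1#               ≈⟨ *-congʳ (F-nil W ∣W∣≡0) ⟩
    1# * 1#                   ≈⟨ *-congˡ (reflexive (≡.cong (pow R q+2) (≡.sym rank≡0))) ⟩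
    1# * pow R q+2 (rank W)    ∎
    where
    rank≡0 : rank W ≡ 0
    rank≡0 = ≡.trans (rank≡ W) (≡.trans (≡.cong (_∸ count (isRoot W)) ∣W∣≡0) (ℕ.0∸n≡0 (count (isRoot W))))
  K≈ (suc k) (suc m) W (s≤s m≤k) ∣W∣≡1+m = begin
    K (suc m) W
      ≈⟨ K-first-block m W ⟩
    - ∑< (suc m) (λ a → ∑ (map (λ B → ζ B * K (m ∸ a) (W ─ B)) (subsetsOfSize (suc a) W)))
      ≈⟨ -‿cong (∑<-cong (suc m) by-size) ⟩
    - ∑< (suc m) (λ a → P * ∑ˢ (λ B → if sized a B then term W B else 0#))
      ≈⟨ -‿cong (∑<-*ˡ (suc m) P (λ a → ∑ˢ (λ B → if sized a B then term W B else 0#))) ⟩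
    - (P * ∑< (suc m) (λ a → ∑ˢ (λ B → if sized a B then term W B else 0#)))
      ≈⟨ -‿cong (*-congˡ (trans (∑-by-size m W (term W) ∣W∣≡1+m) (alternating-nonempty m W ∣W∣≡1+m))) ⟩
    - (P * - Y)
      ≈⟨ -‿cong (sym (-‿distribʳ-* P Y)) ⟩
    - - (P * Y)
      ≈⟨ -‿involutive _ ⟩
    P * Y ∎
    where
    P Y : Carrier
    P = pow R -1ᴿ (suc m)
    Y = pow R q+2 (rank W)
    sized : ℕ → Subset n → Bool
    sized a B = (∣ B ∣ ==ℕ suc a) ∧ (B ⊆ᵇ W)
    one-block : ∀ a B → (if sized a B then ζ B * K (m ∸ a) (W ─ B) else 0#) ≈ P * (if sized a B then term W B else 0#)
    one-block a B with sized a B in sized?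
    ... | false = sym (zeroʳ P)
    ... | true = block-contribution m a W B ∣B∣≡1+a a≤m (K≈ k (m ∸ a) (W ─ B) (ℕ.≤-trans (ℕ.m∸n≤m m a) m≤k) ∣W─B∣≡m∸a)
      where
      ∣B∣≡1+a : ∣ B ∣ ≡ suc a
      ∣B∣≡1+a = ℕ.≡ᵇ⇒≡ ∣ B ∣ (suc a) (Equivalence.from T-≡ (∧-elimˡ sized?))
      B⊆W : B ⊆ W
      B⊆W = ⊆ᵇ⇒⊆ B W (∧-elimʳ {∣ B ∣ ==ℕ suc a} sized?)
      a≤m : a ≤ m
      a≤m = ℕ.≤-pred (ℕ.≤-trans (ℕ.≤-reflexive (≡.sym ∣B∣≡1+a))
                               (ℕ.≤-trans (p⊆q⇒∣p∣≤∣q∣ {B = B} {W} B⊆W) (ℕ.≤-reflexive ∣W∣≡1+m)))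
      ∣W─B∣≡m∸a : ∣ W ─ B ∣ ≡ m ∸ a
      ∣W─B∣≡m∸a = ≡.trans (∣p─q∣≡∣p∣∸∣q∣ W B B⊆W) (≡.cong₂ _∸_ ∣W∣≡1+m ∣B∣≡1+a)
    by-size : ∀ a → ∑ (map (λ B → ζ B * K (m ∸ a) (W ─ B)) (subsetsOfSize (suc a) W))
                    ≈ P * ∑ˢ (λ B → if sized a B then term W B else 0#)
    by-size a = begin
      ∑ (map (λ B → ζ B * K (m ∸ a) (W ─ B)) (subsetsOfSize (suc a) W))
        ≈⟨ ∑-filter (sized a) _ (allSubsets n) ⟩
      ∑ˢ (λ B → if sized a B then ζ B * K (m ∸ a) (W ─ B) else 0#)
        ≈⟨ ∑ˢ-cong (one-block a) ⟩
      ∑ˢ (λ B → P * (if sized a B then term W B else 0#))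
        ≈⟨ ∑-*ˡ P _ (allSubsets n) ⟩
      P * ∑ˢ (λ B → if sized a B then term W B else 0#) ∎

proposition5p2 : {c ℓ : Level} (R : CommutativeRing c ℓ) (q : CommutativeRing.Carrier R)
    (n : ℕ) → 1 ≤ n → (Adj : Fin n → Fin n → Bool) → IsTree Adj → (s : ℕ) → 1 < s →
    CommutativeRing._≈_ R
      (ps1At R n (Psi R q s (graphComplex Adj)) -[1+ 0 ])
      (CommutativeRing._*_ R (pow R (CommutativeRing.-_ R (CommutativeRing.1# R)) n)
        (pow R (CommutativeRing._+_ R q (natR R 2)) (n ∸ 1)))
proposition5p2 R q (suc n) _ Adj tree s 1<s = begin
  ps1At R (suc n) (Psi R q s Γ) -[1+ 0 ]
    -- Psi R q s Γ α is F α full by definition.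
    ≈⟨ ∑-cong (compositions (suc n)) (λ α → *-congˡ (binom-minus-one (length α))) ⟩
  K (suc n) full
    ≈⟨ K≈ (suc n) (suc n) full ℕ.≤-refl (Subset.∣⊤∣≡n (suc n)) ⟩
  pow R -1ᴿ (suc n) * pow R q+2 (rank full)
    ≈⟨ reflexive (≡.cong (λ r → pow R -1ᴿ (suc n) * pow R q+2 r) (rank-full zero)) ⟩
  pow R -1ᴿ (suc n) * pow R q+2 n ∎
  where
  open CommutativeRing R hiding (zero)
  open IsTree tree using (symmetric; irreflexive)
  open GraphComplex Adj symmetric irreflexive using (Γ)
  open Rank Adj symmetric irreflexive using (rank)
  open Tree Adj tree using (rank-full)
  open Sums R using (∑-cong)
  open Signs R using (-1ᴿ; binom-minus-one)
  open AlternatingSum R q Adj tree using (q+2)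
  open FirstBlockExpansion R q s 1<s Adj tree using (K; K≈)
  open import Relation.Binary.Reasoning.Setoid setoid
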